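{- Let $D_1$ and $D_2$ be simple digraphs on $n_1$ and $n_2$ vertices, respectively. Suppose $D_1$ has $m_1$ arcs and its underlying graph $G_1=U(D_1)$ has $m_1'$ edges. Then (i) $\displaystyle f_{A(D_1 \overrightarrow{\diamond} D_2)} (\lambda)=\big[f_{A(D_2)}(\lambda)\big]^{m_1}\left(1+\chi_{A(D_2)}(\lambda)\right)^{n_1}f_{A(D_1)}\left(\frac{\lambda}{1+\chi_{A(D_2)}(\lambda)}\right)$, (ii) $\displaystyle f_{A(D_1 \overleftarrow{\diamond} D_2)}(\lambda)= \big[f_{A(D_2)}(\lambda)\big]^{m_1} \det\left(\lambda I_{n_1}-A(D_1)-\chi_{A(D_2)}(\lambda)\,A(D_1)^T\right)$, (iii) $\displaystyle f_{A(D_1 \overleftrightarrow{\diamond} D_2)}(\lambda)= \big[f_{A(D_2)}(\lambda)\big]^{m_1'} \det\left(\lambda I_{n_1}-A(D_1)-\chi_{A(D_2)}(\lambda)\,Q(G_1)\right)$. In particular, the adjacency spectrum of $D_1 \overrightarrow{\diamond} D_2$ is completely determined by the adjacency characteristic polynomials of $D_1$ and $D_2$ and the $A$-coronal of $D_2$.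
   Context: Digraphs are simple. $A(D)$ is the adjacency matrix of $D$ ($A(D)^T$ is the adjacency matrix of the reverse digraph $\overleftarrow{D}_1$). The underlying graph $U(D)$ has the same vertices and an edge $\{u,v\}$ whenever $uv$ or $vu$ is an arc. For a graph $G$, $Q(G)=D_{\rm deg}(G)+A(G)$ is its signless Laplacian, $D_{\rm deg}(G)$ the diagonal degree matrix. $f_M(\lambda)=\det(\lambda I-M)$; for a real $n\times n$ matrix $M$ over $\mathbb{C}(\lambda)$, $\chi_M(\lambda)=\mathbf{1}_n^T(\lambda I_n-M)^{ -1}\mathbf{1}_n$ ($\mathbf{1}_n$ all-ones vector), and the $A$-coronal of $D$ is $\chi_{A(D)}$. Arc coronas: the forward-arc-corona $D_1 \overrightarrow{\diamond} D_2$ takes one copy of $D_1$ and $m_1$ disjoint copies of $D_2$, one per arc of $D_1$, and for each arc $a_k=uv$ of $D_1$ and each vertex $w$ of the $k$-th copy of $D_2$ adds arcs $uw$ and $wv$. The backward-arc-corona $D_1 \overleftarrow{\diamond} D_2$ is defined the same way but adds arcs $vw$ and $wu$ instead. The symmetric-arc-corona $D_1 \overleftrightarrow{\diamond} D_2$ takes one copy of $D_1$ and $m_1'$ copies of $D_2$, one per edge of $U(D_1)$, and for each edge $\{u,v\}$ of $U(D_1)$ and each vertex $w$ of the corresponding copy of $D_2$ adds arcs $uw,wu,vw,wv$. -}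

module Defs where

open import Level using (Level)
open import Data.Bool using (Bool; true; false; if_then_else_; _∧_; _∨_)
open import Data.Nat as ℕ using (ℕ; zero; suc; _<ᵇ_)
open import Data.Fin as Fin using (Fin; zero; suc; toℕ; splitAt; remQuot; punchIn)
open import Data.Fin.Properties using () renaming (_≟_ to _≟F_)
open import Data.Sum using (inj₁; inj₂)
open import Data.Product using (_×_; _,_; proj₁; proj₂)
open import Data.List as List using (List; []; [_]; concatMap; length; lookup; allFin)
open import Relation.Nullary.Decidable using (⌊_⌋)
open import Relation.Binary.PropositionalEquality using (_≡_)
open import Algebra.Bundles using (CommutativeRing)

-- Simple digraphs on vertex set Fin n: an arc relation with no loops
-- (a Bool-valued relation automatically has no multiple arcs).

record Digraph (n : ℕ) : Set where
  field
    arc      : Fin n → Fin n → Bool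
    loopless : ∀ u → arc u u ≡ false
open Digraph public

_==_ : ∀ {n} → Fin n → Fin n → Bool
i == j = ⌊ i ≟F j ⌋

arcs : ∀ {n} → Digraph n → List (Fin n × Fin n)
arcs {n} D = concatMap (λ u → concatMap (λ v →
  if arc D u v then [ (u , v) ] else []) (allFin n)) (allFin n)

numArcs : ∀ {n} → Digraph n → ℕ
numArcs D = length (arcs D)

uadj : ∀ {n} → Digraph n → Fin n → Fin n → Bool
uadj D u v = arc D u v ∨ arc D v u

uedges : ∀ {n} → Digraph n → List (Fin n × Fin n)
uedges {n} D = concatMap (λ u → concatMap (λ v →
  if (toℕ u <ᵇ toℕ v) ∧ uadj D u v then [ (u , v) ] else []) (allFin n)) (allFin n)

numEdges : ∀ {n} → Digraph n → ℕ
numEdges D = length (uedges D)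

-- Vertices: Fin (n₁ + m * n₂); the first n₁
-- are D₁, then the k-th copy of D₂ (k : Fin m) occupies a block of n₂.
-- toW k u  : whether arc u → w is added for w in copy k,
-- fromW k v : whether arc w → v is added for w in copy k.

coronaArc : ∀ {n₁ n₂} m → Digraph n₁ → Digraph n₂ →
            (Fin m → Fin n₁ → Bool) → (Fin m → Fin n₁ → Bool) →
            Fin (n₁ ℕ.+ m ℕ.* n₂) → Fin (n₁ ℕ.+ m ℕ.* n₂) → Bool
coronaArc {n₁} {n₂} m D₁ D₂ toW fromW i j with splitAt n₁ i | splitAt n₁ j
... | inj₁ u | inj₁ v = arc D₁ u v
... | inj₁ u | inj₂ q = toW (proj₁ (remQuot {m} n₂ q)) u
... | inj₂ p | inj₁ v = fromW (proj₁ (remQuot {m} n₂ p)) v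
... | inj₂ p | inj₂ q =
  (proj₁ (remQuot {m} n₂ p) == proj₁ (remQuot {m} n₂ q))
  ∧ arc D₂ (proj₂ (remQuot {m} n₂ p)) (proj₂ (remQuot {m} n₂ q))

fwdArc : ∀ {n₁ n₂} (D₁ : Digraph n₁) → Digraph n₂ →
         Fin (n₁ ℕ.+ numArcs D₁ ℕ.* n₂) → Fin (n₁ ℕ.+ numArcs D₁ ℕ.* n₂) → Bool
fwdArc D₁ D₂ = coronaArc (numArcs D₁) D₁ D₂
  (λ k x → x == proj₁ (lookup (arcs D₁) k))
  (λ k x → x == proj₂ (lookup (arcs D₁) k))

bwdArc : ∀ {n₁ n₂} (D₁ : Digraph n₁) → Digraph n₂ →
         Fin (n₁ ℕ.+ numArcs D₁ ℕ.* n₂) → Fin (n₁ ℕ.+ numArcs D₁ ℕ.* n₂) → Bool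
bwdArc D₁ D₂ = coronaArc (numArcs D₁) D₁ D₂
  (λ k x → x == proj₂ (lookup (arcs D₁) k))
  (λ k x → x == proj₁ (lookup (arcs D₁) k))

symArc : ∀ {n₁ n₂} (D₁ : Digraph n₁) → Digraph n₂ →
         Fin (n₁ ℕ.+ numEdges D₁ ℕ.* n₂) → Fin (n₁ ℕ.+ numEdges D₁ ℕ.* n₂) → Bool
symArc D₁ D₂ = coronaArc (numEdges D₁) D₁ D₂
  (λ k x → (x == proj₁ (lookup (uedges D₁) k)) ∨ (x == proj₂ (lookup (uedges D₁) k)))
  (λ k x → (x == proj₁ (lookup (uedges D₁) k)) ∨ (x == proj₂ (lookup (uedges D₁) k)))

module _ {c ℓ : Level} (R : CommutativeRing c ℓ) where
  open CommutativeRing R hiding (zero)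

  Mat : ℕ → ℕ → Set c
  Mat m n = Fin m → Fin n → Carrier

  Σ[_] : ∀ n → (Fin n → Carrier) → Carrier
  Σ[ zero ] f = 0#
  Σ[ suc n ] f = f zero + Σ[ n ] (λ i → f (suc i))

  pow : Carrier → ℕ → Carrier
  pow x zero = 1#
  pow x (suc k) = x * pow x k

  sgn : ℕ → Carrier
  sgn zero = 1#
  sgn (suc k) = - sgn k

  det : ∀ {n} → Mat n n → Carrier
  det {zero} M = 1#
  det {suc n} M = Σ[ suc n ] (λ j →
    sgn (toℕ j) * (M zero j * det (λ i k → M (suc i) (punchIn j k))))

  _⊗_ : ∀ {m n p} → Mat m n → Mat n p → Mat m p
  (A ⊗ B) i k = Σ[ _ ] (λ j → A i j * B j k)

  idMat : ∀ {n} → Mat n n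
  idMat i j = if i == j then 1# else 0#

  ⟦_⟧ : Bool → Carrier
  ⟦ b ⟧ = if b then 1# else 0#

  A : ∀ {n} → Digraph n → Mat n n
  A D i j = ⟦ arc D i j ⟧

  relMat : ∀ {n} → (Fin n → Fin n → Bool) → Mat n n
  relMat r i j = ⟦ r i j ⟧

  charMat : ∀ {n} → Carrier → Mat n n → Mat n n
  charMat λ' M i j = (if i == j then λ' else 0#) - M i j

  charPoly : ∀ {n} → Mat n n → Carrier → Carrier
  charPoly M λ' = det (charMat λ' M)

  -- χ given the inverse N = (λ I - M)⁻¹ : 1ᵀ N 1
  coronalOf : ∀ {n} → Mat n n → Carrier
  coronalOf {n} N = Σ[ n ] (λ i → Σ[ n ] (λ j → N i j))

  IsInverse : ∀ {n} → Mat n n → Mat n n → Set ℓ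
  IsInverse M N = ∀ i j → (M ⊗ N) i j ≈ idMat i j

  degree : ∀ {n} → Digraph n → Fin n → Carrier
  degree {n} D u = Σ[ n ] (λ v → ⟦ uadj D u v ⟧)

  Q : ∀ {n} → Digraph n → Mat n n
  Q D i j = (if i == j then degree D i else 0#) + ⟦ uadj D i j ⟧

  bwdMat : ∀ {n} → Carrier → Carrier → Digraph n → Mat n n
  bwdMat λ' χ D i j = charMat λ' (A D) i j - χ * A D j i

  symMat : ∀ {n} → Carrier → Carrier → Digraph n → Mat n n
  symMat λ' χ D i j = charMat λ' (A D) i j - χ * Q D i j

-- λI − A of an arc corona is a block matrix [[λI − A(D₁), −T], [−F, diag(λI − A(D₂), …, λI − A(D₂))]]:
-- the k-th copy of D₂ meets D₁ only through the indicator vectors T k, F k of the endpoints of the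
-- k-th arc (or edge) of D₁. From (λI − A(D₂))N = I, the vector ρ = N𝟏 satisfies (λI − A(D₂))ρ = 𝟏,
-- so adding ρ-weighted combinations of the copy columns to the D₁ columns clears the block −F. The
-- determinant becomes f_{A(D₂)}(λ)^m times the determinant of the Schur complement
-- λI − A(D₁) − χ Σₖ T k F kᵀ with χ = 𝟏ᵀρ, and summing the indicator products over the arcs gives
-- A(D₁) or A(D₁)ᵀ, over the edges of U(D₁) the signless Laplacian Q(G₁).
module Submission where

open import Defs
open import Level using (Level)
open import Data.Nat using (ℕ)
open import Data.Product using (_×_)
open import Algebra.Bundles using (CommutativeRing)

open import Data.Nat as ℕ using (zero; suc; _<ᵇ_)
import Data.Nat.Properties as ℕ
open import Data.Fin as Fin using (Fin; zero; suc; toℕ; punchIn; inject₁; _↑ˡ_; _↑ʳ_; splitAt; combine; remQuot; quotient; remainder)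
import Data.Fin.Properties as Fin
open import Data.Vec.Functional using (updateAt)
open import Data.Vec.Functional.Properties using (updateAt-updates; updateAt-minimal)
open import Data.Product using (_,_; proj₁; proj₂; ∃-syntax)
open import Data.Sum using (_⊎_; inj₁; inj₂)
open import Data.Bool using (Bool; true; false; if_then_else_; _∧_; _∨_; T)
open import Data.Bool.Properties using (∨-comm)
open import Data.List as List using (List; []; _∷_; [_]; _++_; concatMap; length; lookup; allFin; tabulate)
open import Data.Empty using (⊥-elim)
open import Function using (_∘_)
open import Relation.Nullary using (Dec; yes; no; ¬_)
open import Relation.Binary.Definitions using (tri<; tri≈; tri>)
open import Relation.Binary.PropositionalEquality as ≡ using (_≡_; _≢_)

punchIn-inject₁-self : ∀ {n} (i : Fin n) → punchIn (inject₁ i) i ≡ suc i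
punchIn-inject₁-self zero    = ≡.refl
punchIn-inject₁-self (suc i) = ≡.cong suc (punchIn-inject₁-self i)

punchIn-suc-self : ∀ {n} (i : Fin n) → punchIn (suc i) i ≡ inject₁ i
punchIn-suc-self zero    = ≡.refl
punchIn-suc-self (suc i) = ≡.cong suc (punchIn-suc-self i)

punchIn-inject₁≡punchIn-suc : ∀ {n} (i k : Fin n) → k ≢ i → punchIn (inject₁ i) k ≡ punchIn (suc i) k
punchIn-inject₁≡punchIn-suc zero    zero    k≢i = ⊥-elim (k≢i ≡.refl)
punchIn-inject₁≡punchIn-suc zero    (suc k) _   = ≡.refl
punchIn-inject₁≡punchIn-suc (suc i) zero    _   = ≡.refl
punchIn-inject₁≡punchIn-suc (suc i) (suc k) k≢i = ≡.cong suc (punchIn-inject₁≡punchIn-suc i k (k≢i ∘ ≡.cong suc))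

punchIn-adjacent : ∀ {n} (j : Fin (suc (suc n))) (i : Fin (suc n)) → j ≢ inject₁ i → j ≢ suc i →
  ∃[ i′ ] punchIn j (inject₁ i′) ≡ inject₁ i × punchIn j (suc i′) ≡ suc i
punchIn-adjacent zero          zero    j≢i _    = ⊥-elim (j≢i ≡.refl)
punchIn-adjacent zero          (suc i) _   _    = i , ≡.refl , ≡.refl
punchIn-adjacent {zero}  (suc zero)    zero    _   j≢si = ⊥-elim (j≢si ≡.refl)
punchIn-adjacent {suc n} (suc zero)    zero    _   j≢si = ⊥-elim (j≢si ≡.refl)
punchIn-adjacent {suc n} (suc (suc j)) zero    _   _    = zero , ≡.refl , ≡.refl
punchIn-adjacent {suc n} (suc j)       (suc i) j≢i j≢si
  with i′ , p , q ← punchIn-adjacent j i (j≢i ∘ ≡.cong suc) (j≢si ∘ ≡.cong suc) =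
  suc i′ , ≡.cong suc p , ≡.cong suc q

inject₁≢suc : ∀ {n} (i : Fin n) → inject₁ i ≢ suc i
inject₁≢suc zero    ()
inject₁≢suc (suc i) eq = inject₁≢suc i (Fin.suc-injective eq)

toℕ-punchIn-≤ : ∀ {n} (j : Fin (suc n)) (k : Fin n) → toℕ (punchIn j k) ℕ.≤ suc (toℕ k)
toℕ-punchIn-≤ zero    k       = ℕ.≤-refl
toℕ-punchIn-≤ (suc j) zero    = ℕ.z≤n
toℕ-punchIn-≤ (suc j) (suc k) = ℕ.s≤s (toℕ-punchIn-≤ j k)

toℕ-punchIn-< : ∀ {n} (j : Fin (suc n)) (k : Fin n) → toℕ k ℕ.< toℕ j → toℕ (punchIn j k) ≡ toℕ k
toℕ-punchIn-< (suc j) zero    _           = ≡.refl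
toℕ-punchIn-< (suc j) (suc k) (ℕ.s≤s k<j) = ≡.cong suc (toℕ-punchIn-< j k k<j)

punchIn-↑ˡ : ∀ {a} b (u : Fin (suc a)) (k : Fin a) → punchIn (u ↑ˡ b) (k ↑ˡ b) ≡ punchIn u k ↑ˡ b
punchIn-↑ˡ b zero    k       = ≡.refl
punchIn-↑ˡ b (suc u) zero    = ≡.refl
punchIn-↑ˡ b (suc u) (suc k) = ≡.cong suc (punchIn-↑ˡ b u k)

punchIn-↑ˡ-↑ʳ : ∀ a {b} (u : Fin (suc a)) (k : Fin b) → punchIn (u ↑ˡ b) (a ↑ʳ k) ≡ suc a ↑ʳ k
punchIn-↑ˡ-↑ʳ a       zero    k = ≡.refl
punchIn-↑ˡ-↑ʳ (suc a) (suc u) k = ≡.cong suc (punchIn-↑ˡ-↑ʳ a u k)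

↑ˡ-of-< : ∀ a {b} (x : Fin (a ℕ.+ b)) (x<a : toℕ x ℕ.< a) → x ≡ Fin.fromℕ< x<a ↑ˡ b
↑ˡ-of-< a x x<a = ≡.sym (Fin.splitAt⁻¹-↑ˡ (Fin.splitAt-< a x x<a))

↑ʳ-of-≥ : ∀ a {b} (x : Fin (a ℕ.+ b)) (a≤x : a ℕ.≤ toℕ x) → x ≡ a ↑ʳ Fin.reduce≥ x a≤x
↑ʳ-of-≥ a x a≤x = ≡.sym (Fin.splitAt⁻¹-↑ʳ (Fin.splitAt-≥ a x a≤x))

remQuot-↑ʳ : ∀ {m} n (p : Fin (m ℕ.* n)) → remQuot {suc m} n (n ↑ʳ p) ≡ (suc (quotient n p) , remainder {m} n p)
remQuot-↑ʳ {m} n p = ≡.trans (≡.cong (λ q → remQuot {suc m} n (n ↑ʳ q)) (≡.sym (Fin.combine-remQuot {m} n p)))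
                             (Fin.remQuot-combine (suc (quotient n p)) (remainder {m} n p))

↑ʳ≢↑ˡ : ∀ a {b} (w : Fin b) (u : Fin a) → a ↑ʳ w ≢ u ↑ˡ b
↑ʳ≢↑ˡ a {b} w u eq with () ← ≡.trans (≡.sym (Fin.splitAt-↑ʳ a b w)) (≡.trans (≡.cong (splitAt a) eq) (Fin.splitAt-↑ˡ a u b))

<ᵇ≡true⇒< : ∀ m n → (m <ᵇ n) ≡ true → m ℕ.< n
<ᵇ≡true⇒< m n eq = ℕ.<ᵇ⇒< m n (≡.subst T (≡.sym eq) _)

<ᵇ≡false⇒≮ : ∀ m n → (m <ᵇ n) ≡ false → ¬ m ℕ.< n
<ᵇ≡false⇒≮ m n eq m<n = ≡.subst T eq (ℕ.<⇒<ᵇ m<n)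

==-true : ∀ {n} {i j : Fin n} → i ≡ j → (i == j) ≡ true
==-true {i = i} {j} i≡j with i Fin.≟ j
... | yes _   = ≡.refl
... | no i≢j = ⊥-elim (i≢j i≡j)

==-false : ∀ {n} {i j : Fin n} → i ≢ j → (i == j) ≡ false
==-false {i = i} {j} i≢j with i Fin.≟ j
... | yes i≡j = ⊥-elim (i≢j i≡j)
... | no _    = ≡.refl

==-iff : ∀ {n n′} {i j : Fin n} {i′ j′ : Fin n′} → (i ≡ j → i′ ≡ j′) → (i′ ≡ j′ → i ≡ j) → (i == j) ≡ (i′ == j′)
==-iff {i = i} {j} to from with i Fin.≟ j
... | yes i≡j = ≡.sym (==-true (to i≡j))
... | no i≢j  = ≡.sym (==-false (i≢j ∘ from))

quotient-remainder-injective : ∀ {m n} {p q : Fin (m ℕ.* n)} → quotient {m} n p ≡ quotient {m} n q →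
  remainder {m} n p ≡ remainder {m} n q → p ≡ q
quotient-remainder-injective {m} {n} {p} {q} q≡ r≡ = ≡.trans (≡.sym (Fin.combine-remQuot {m} n p))
  (≡.trans (≡.cong₂ combine q≡ r≡) (Fin.combine-remQuot {m} n q))

module Summation {c ℓ : Level} (R : CommutativeRing c ℓ) where
  open CommutativeRing R hiding (zero)
  open import Algebra.Properties.Semiring.Sum semiring public
    using (sum; sum-syntax; sum-cong-≋; sum-replicate-zero; sum-remove; ∑-distrib-+; ∑-comm; *-distribˡ-sum; *-distribʳ-sum)
  open import Algebra.Properties.Ring ring using (-1*x≈-x)
  open import Relation.Binary.Reasoning.Setoid setoid

  -- Σ[_] unfolds like the library sum, but for a variable length the two agree only propositionally.
  Σ≡sum : ∀ n (f : Fin n → Carrier) → Σ[_] R n f ≡ sum f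
  Σ≡sum zero    f = ≡.refl
  Σ≡sum (suc n) f = ≡.cong (f zero +_) (Σ≡sum n (λ k → f (suc k)))

  sum-zero : ∀ {n} {f : Fin n → Carrier} → (∀ i → f i ≈ 0#) → sum f ≈ 0#
  sum-zero {n} f≈0 = trans (sum-cong-≋ f≈0) (sum-replicate-zero n)

  sum-single : ∀ {n} (f : Fin n → Carrier) (i : Fin n) → (∀ j → j ≢ i → f j ≈ 0#) → sum f ≈ f i
  sum-single {suc n} f i f≈0 = begin
    sum f                       ≈⟨ sum-remove f ⟩
    f i + sum (f ∘ punchIn i)   ≈⟨ +-congˡ (sum-zero (λ k → f≈0 (punchIn i k) (Fin.punchInᵢ≢i i k))) ⟩
    f i + 0#                    ≈⟨ +-identityʳ (f i) ⟩
    f i                         ∎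

  sum-neg : ∀ {n} (f : Fin n → Carrier) → sum (λ i → - f i) ≈ - sum f
  sum-neg f = begin
    sum (λ i → - f i)      ≈⟨ sum-cong-≋ (λ i → sym (-1*x≈-x (f i))) ⟩
    sum (λ i → - 1# * f i) ≈⟨ sym (*-distribˡ-sum (- 1#) f) ⟩
    - 1# * sum f           ≈⟨ -1*x≈-x (sum f) ⟩
    - sum f                ∎

  sum-↑ : ∀ a {b} (f : Fin (a ℕ.+ b) → Carrier) → sum f ≈ sum (λ i → f (i ↑ˡ b)) + sum (λ i → f (a ↑ʳ i))
  sum-↑ zero    f = sym (+-identityˡ _)
  sum-↑ (suc a) f = trans (+-congˡ (sum-↑ a (λ k → f (suc k)))) (sym (+-assoc _ _ _))

  sum-combine : ∀ m {n} (f : Fin (m ℕ.* n) → Carrier) → sum f ≈ ∑[ k < m ] ∑[ w < n ] f (combine k w)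
  sum-combine zero    f = refl
  sum-combine (suc m) {n} f = trans (sum-↑ n f) (+-congˡ (sum-combine m (λ k → f (n ↑ʳ k))))

  sum-adjacent-cancel : ∀ {n} (t : Fin (suc n) → Carrier) (i : Fin n) →
    (∀ j → j ≢ inject₁ i → j ≢ suc i → t j ≈ 0#) → t (inject₁ i) + t (suc i) ≈ 0# → sum t ≈ 0#
  sum-adjacent-cancel {suc n} t zero t≈0 pair = begin
    t zero + (t (suc zero) + sum (λ k → t (suc (suc k))))
      ≈⟨ sym (+-assoc _ _ _) ⟩
    (t zero + t (suc zero)) + sum (λ k → t (suc (suc k)))
      ≈⟨ +-cong pair (sum-zero (λ k → t≈0 (suc (suc k)) (λ ()) (λ ()))) ⟩
    0# + 0#
      ≈⟨ +-identityʳ 0# ⟩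
    0# ∎
  sum-adjacent-cancel {suc n} t (suc i) t≈0 pair = begin
    t zero + sum (λ k → t (suc k))
      ≈⟨ +-cong (t≈0 zero (λ ()) (λ ())) (sum-adjacent-cancel (λ k → t (suc k)) i t≈0′ pair) ⟩
    0# + 0#
      ≈⟨ +-identityʳ 0# ⟩
    0# ∎
    where
    t≈0′ : ∀ j → j ≢ inject₁ i → j ≢ suc i → t (suc j) ≈ 0#
    t≈0′ j j≢i j≢si = t≈0 (suc j) (j≢i ∘ Fin.suc-injective) (j≢si ∘ Fin.suc-injective)

  idMat-diag : ∀ {n} (i : Fin n) → idMat R i i ≈ 1#
  idMat-diag i = reflexive (≡.cong (⟦_⟧ R) (==-true {i = i} ≡.refl))

  idMat-off : ∀ {n} {i j : Fin n} → i ≢ j → idMat R i j ≈ 0#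
  idMat-off i≢j = reflexive (≡.cong (⟦_⟧ R) (==-false i≢j))

  sum-idMatˡ : ∀ {n} (i : Fin n) (f : Fin n → Carrier) → ∑[ j < n ] (idMat R i j * f j) ≈ f i
  sum-idMatˡ {n} i f = begin
    ∑[ j < n ] (idMat R i j * f j) ≈⟨ sum-single _ i (λ j j≢i → trans (*-congʳ (idMat-off (j≢i ∘ ≡.sym))) (zeroˡ (f j))) ⟩
    idMat R i i * f i            ≈⟨ trans (*-congʳ (idMat-diag i)) (*-identityˡ (f i)) ⟩
    f i                          ∎

  idMat-suc : ∀ {n} (i j : Fin n) → idMat R (suc i) (suc j) ≈ idMat R i j
  idMat-suc i j with i Fin.≟ j
  ... | yes _ = refl
  ... | no _  = refl

  sum-symmetrize : ∀ {n} (C U g : Fin n → Fin n → Carrier) → (∀ a b → C a b + C b a ≈ U a b) →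
    ∑[ a < n ] ∑[ b < n ] (C a b * (g a b + g b a)) ≈ ∑[ a < n ] ∑[ b < n ] (U a b * g a b)
  sum-symmetrize {n} C U g C+Cᵀ≈U = begin
    ∑[ a < n ] ∑[ b < n ] (C a b * (g a b + g b a))
      ≈⟨ sum₂-distrib-+ (λ a b → distribˡ (C a b) (g a b) (g b a)) ⟩
    ∑[ a < n ] ∑[ b < n ] (C a b * g a b) + ∑[ a < n ] ∑[ b < n ] (C a b * g b a)
      ≈⟨ +-congˡ (∑-comm (λ a b → C a b * g b a)) ⟩
    ∑[ a < n ] ∑[ b < n ] (C a b * g a b) + ∑[ a < n ] ∑[ b < n ] (C b a * g a b)
      ≈⟨ sym (sum₂-distrib-+ (λ a b → distribʳ (g a b) (C a b) (C b a))) ⟩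
    ∑[ a < n ] ∑[ b < n ] ((C a b + C b a) * g a b)
      ≈⟨ sum-cong-≋ (λ a → sum-cong-≋ (λ b → *-congʳ (C+Cᵀ≈U a b))) ⟩
    ∑[ a < n ] ∑[ b < n ] (U a b * g a b) ∎
    where
    sum₂-distrib-+ : ∀ {f g h : Fin n → Fin n → Carrier} → (∀ a b → f a b ≈ g a b + h a b) →
      ∑[ a < n ] ∑[ b < n ] f a b ≈ ∑[ a < n ] ∑[ b < n ] g a b + ∑[ a < n ] ∑[ b < n ] h a b
    sum₂-distrib-+ {f} {g} {h} f≈g+h = trans (sum-cong-≋ (λ a → trans (sum-cong-≋ (f≈g+h a)) (∑-distrib-+ (g a) (h a))))
                                             (∑-distrib-+ (λ a → sum (g a)) (λ a → sum (h a)))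

  sum-linear : ∀ {n} (a b : Carrier) {f g h : Fin n → Carrier} → (∀ j → f j ≈ a * g j + b * h j) →
               sum f ≈ a * sum g + b * sum h
  sum-linear a b {f} {g} {h} f≈ = begin
    sum f                                     ≈⟨ sum-cong-≋ f≈ ⟩
    sum (λ j → a * g j + b * h j)             ≈⟨ ∑-distrib-+ (λ j → a * g j) (λ j → b * h j) ⟩
    sum (λ j → a * g j) + sum (λ j → b * h j) ≈⟨ sym (+-cong (*-distribˡ-sum a g) (*-distribˡ-sum b h)) ⟩
    a * sum g + b * sum h                     ∎

module Determinant {c ℓ : Level} (R : CommutativeRing c ℓ) where
  open CommutativeRing R hiding (zero)
  open Summation R
  open import Algebra.Properties.Ring ring using (-‿distribˡ-*; +-inverseʳ-unique; -‿involutive; -0#≈0#)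
  open import Algebra.Solver.Ring.NaturalCoefficients.Default commutativeSemiring using (solve; _:+_; _:*_; _:=_)
  open import Relation.Binary.Reasoning.Setoid setoid

  infix 4 _≋_
  _≋_ : ∀ {m n} → Mat R m n → Mat R m n → Set ℓ
  M ≋ N = ∀ i j → M i j ≈ N i j

  minor : ∀ {n} → Mat R (suc n) (suc n) → Fin (suc n) → Mat R n n
  minor M j i k = M (suc i) (punchIn j k)

  laplaceTerm : ∀ {n} → Mat R (suc n) (suc n) → Fin (suc n) → Carrier
  laplaceTerm M j = sgn R (toℕ j) * (M zero j * det R (minor M j))

  laplaceTerm-zero : ∀ {n} (M : Mat R (suc n) (suc n)) j → det R (minor M j) ≈ 0# → laplaceTerm M j ≈ 0#
  laplaceTerm-zero M j minor≈0 = begin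
    sgn R (toℕ j) * (M zero j * det R (minor M j)) ≈⟨ *-congˡ (*-congˡ minor≈0) ⟩
    sgn R (toℕ j) * (M zero j * 0#)               ≈⟨ *-congˡ (zeroʳ (M zero j)) ⟩
    sgn R (toℕ j) * 0#                            ≈⟨ zeroʳ _ ⟩
    0#                                            ∎

  det-expand : ∀ {n} (M : Mat R (suc n) (suc n)) → det R M ≡ sum (laplaceTerm M)
  det-expand {n} M = Σ≡sum (suc n) (laplaceTerm M)

  det-cong : ∀ {n} {M N : Mat R n n} → M ≋ N → det R M ≈ det R N
  det-cong {zero}          M≋N = refl
  det-cong {suc n} {M} {N} M≋N = begin
    det R M                ≡⟨ det-expand M ⟩
    sum (laplaceTerm M)    ≈⟨ sum-cong-≋ (λ j → *-congˡ {sgn R (toℕ j)} (*-cong (M≋N zero j) (det-cong (λ i k → M≋N (suc i) (punchIn j k))))) ⟩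
    sum (laplaceTerm N)    ≡⟨ det-expand N ⟨
    det R N                ∎

  det-linear-column : ∀ {n} (c : Fin n) (a b : Carrier) (M M′ M″ : Mat R n n) →
    (∀ i → M″ i c ≈ a * M i c + b * M′ i c) →
    (∀ i j → j ≢ c → M″ i j ≈ M i j) → (∀ i j → j ≢ c → M′ i j ≈ M i j) →
    det R M″ ≈ a * det R M + b * det R M′
  det-linear-column {suc n} c a b M M′ M″ at-c M″≈M M′≈M = begin
    det R M″                                           ≡⟨ det-expand M″ ⟩
    sum (laplaceTerm M″)                               ≈⟨ sum-linear a b term ⟩
    a * sum (laplaceTerm M) + b * sum (laplaceTerm M′) ≡⟨ ≡.cong₂ (λ x y → a * x + b * y) (det-expand M) (det-expand M′) ⟨
    a * det R M + b * det R M′                         ∎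
    where
    term : ∀ j → laplaceTerm M″ j ≈ a * laplaceTerm M j + b * laplaceTerm M′ j
    term j with j Fin.≟ c
    ... | yes ≡.refl = begin
      s * (M″ zero j * d″)                       ≈⟨ *-congˡ (*-cong (at-c zero) (det-cong minor″≋minor)) ⟩
      s * ((a * M zero j + b * M′ zero j) * d)   ≈⟨ solve 6 (λ a b s x y d → s :* ((a :* x :+ b :* y) :* d) := a :* (s :* (x :* d)) :+ b :* (s :* (y :* d))) refl a b s (M zero j) (M′ zero j) d ⟩
      a * (s * (M zero j * d)) + b * (s * (M′ zero j * d))
        ≈⟨ +-congˡ (*-congˡ (*-congˡ (*-congˡ (det-cong minor≋minor′)))) ⟩
      a * laplaceTerm M j + b * laplaceTerm M′ j ∎
      where
      s = sgn R (toℕ j)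
      d = det R (minor M j)
      d″ = det R (minor M″ j)
      minor″≋minor : minor M″ j ≋ minor M j
      minor″≋minor i k = M″≈M (suc i) (punchIn j k) (Fin.punchInᵢ≢i j k)
      minor≋minor′ : minor M j ≋ minor M′ j
      minor≋minor′ i k = sym (M′≈M (suc i) (punchIn j k) (Fin.punchInᵢ≢i j k))
    ... | no j≢c = begin
      s * (M″ zero j * det R (minor M″ j))
        ≈⟨ *-congˡ (*-cong (M″≈M zero j j≢c) minors-linear) ⟩
      s * (M zero j * (a * det R (minor M j) + b * det R (minor M′ j)))
        ≈⟨ solve 6 (λ a b s x d d′ → s :* (x :* (a :* d :+ b :* d′)) := a :* (s :* (x :* d)) :+ b :* (s :* (x :* d′))) refl a b s (M zero j) _ _ ⟩
      a * laplaceTerm M j + b * (s * (M zero j * det R (minor M′ j)))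
        ≈⟨ +-congˡ (*-congˡ (*-congˡ (*-congʳ (sym (M′≈M zero j j≢c))))) ⟩
      a * laplaceTerm M j + b * laplaceTerm M′ j ∎
      where
      s = sgn R (toℕ j)
      c′ = Fin.punchOut j≢c
      off-c′ : ∀ {k} → k ≢ c′ → punchIn j k ≢ c
      off-c′ k≢c′ eq = k≢c′ (Fin.punchIn-injective j _ c′ (≡.trans eq (≡.sym (Fin.punchIn-punchOut j≢c))))
      minors-linear : det R (minor M″ j) ≈ a * det R (minor M j) + b * det R (minor M′ j)
      minors-linear = det-linear-column c′ a b (minor M j) (minor M′ j) (minor M″ j)
        (λ i → ≡.subst (λ z → M″ (suc i) z ≈ a * M (suc i) z + b * M′ (suc i) z) (≡.sym (Fin.punchIn-punchOut j≢c)) (at-c (suc i)))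
        (λ i k k≢c′ → M″≈M (suc i) (punchIn j k) (off-c′ k≢c′))
        (λ i k k≢c′ → M′≈M (suc i) (punchIn j k) (off-c′ k≢c′))

  det-zero-column : ∀ {n} (M : Mat R n n) (c : Fin n) → (∀ i → M i c ≈ 0#) → det R M ≈ 0#
  det-zero-column M c M≈0 = begin
    det R M                    ≈⟨ det-linear-column c 0# 0# M M M at-c (λ _ _ _ → refl) (λ _ _ _ → refl) ⟩
    0# * det R M + 0# * det R M ≈⟨ +-cong (zeroˡ _) (zeroˡ _) ⟩
    0# + 0#                     ≈⟨ +-identityʳ 0# ⟩
    0#                          ∎
    where
    at-c : ∀ i → M i c ≈ 0# * M i c + 0# * M i c
    at-c i = trans (M≈0 i) (sym (trans (+-cong (zeroˡ _) (zeroˡ _)) (+-identityʳ 0#)))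

  det-adjacent-equal-columns : ∀ {n} (M : Mat R (suc n) (suc n)) (i : Fin n) →
    (∀ r → M r (inject₁ i) ≈ M r (suc i)) → det R M ≈ 0#
  det-adjacent-equal-columns {suc n} M i equal = begin
    det R M             ≡⟨ det-expand M ⟩
    sum (laplaceTerm M) ≈⟨ sum-adjacent-cancel (laplaceTerm M) i other-term-zero pair-cancels ⟩
    0#                  ∎
    where
    other-term-zero : ∀ j → j ≢ inject₁ i → j ≢ suc i → laplaceTerm M j ≈ 0#
    other-term-zero j j≢i j≢si with i′ , p , q ← punchIn-adjacent j i j≢i j≢si =
      laplaceTerm-zero M j (det-adjacent-equal-columns (minor M j) i′
        (λ r → ≡.subst₂ (λ x y → M (suc r) x ≈ M (suc r) y) (≡.sym p) (≡.sym q) (equal (suc r))))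
    minors-equal : minor M (inject₁ i) ≋ minor M (suc i)
    minors-equal r k with k Fin.≟ i
    ... | yes ≡.refl = ≡.subst₂ (λ x y → M (suc r) x ≈ M (suc r) y)
                         (≡.sym (punchIn-inject₁-self k)) (≡.sym (punchIn-suc-self k)) (sym (equal (suc r)))
    ... | no k≢i = reflexive (≡.cong (M (suc r)) (punchIn-inject₁≡punchIn-suc i k k≢i))
    pair-cancels : laplaceTerm M (inject₁ i) + laplaceTerm M (suc i) ≈ 0#
    pair-cancels = begin
      laplaceTerm M (inject₁ i) + laplaceTerm M (suc i)
        ≡⟨ ≡.cong (λ t → sgn R t * (M zero (inject₁ i) * det R (minor M (inject₁ i))) + laplaceTerm M (suc i)) (Fin.toℕ-inject₁ i) ⟩
      s * x + - s * (M zero (suc i) * det R (minor M (suc i)))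
        ≈⟨ +-congˡ (*-congˡ (*-cong (sym (equal zero)) (sym (det-cong minors-equal)))) ⟩
      s * x + - s * x  ≈⟨ +-congˡ (sym (-‿distribˡ-* s x)) ⟩
      s * x - s * x    ≈⟨ -‿inverseʳ (s * x) ⟩
      0#               ∎
      where
      s = sgn R (toℕ i)
      x = M zero (inject₁ i) * det R (minor M (inject₁ i))

  replaceColumn : ∀ {n} → Mat R n n → Fin n → (Fin n → Carrier) → Mat R n n
  replaceColumn M c x i = updateAt (M i) c (λ _ → x i)

  replaceColumn-at : ∀ {n} (M : Mat R n n) c x i → replaceColumn M c x i c ≡ x i
  replaceColumn-at M c x i = updateAt-updates c (M i)

  replaceColumn-off : ∀ {n} (M : Mat R n n) c x i j → j ≢ c → replaceColumn M c x i j ≡ M i j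
  replaceColumn-off M c x i j j≢c = updateAt-minimal j c (M i) j≢c

  replaceColumn-self : ∀ {n} (M : Mat R n n) c → replaceColumn M c (λ i → M i c) ≋ M
  replaceColumn-self M c i j with j Fin.≟ c
  ... | yes ≡.refl = reflexive (replaceColumn-at M c (λ i → M i c) i)
  ... | no j≢c     = reflexive (replaceColumn-off M c (λ i → M i c) i j j≢c)

  replaceColumn-cong : ∀ {n} (M : Mat R n n) c {x y} → (∀ i → x i ≈ y i) → replaceColumn M c x ≋ replaceColumn M c y
  replaceColumn-cong M c {x} {y} x≈y i j with j Fin.≟ c
  ... | yes ≡.refl = ≡.subst₂ _≈_ (≡.sym (replaceColumn-at M c x i)) (≡.sym (replaceColumn-at M c y i)) (x≈y i)
  ... | no j≢c     = reflexive (≡.trans (replaceColumn-off M c x i j j≢c) (≡.sym (replaceColumn-off M c y i j j≢c)))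

  replaceColumn-comm : ∀ {n} (M : Mat R n n) {c d} x y → c ≢ d →
    replaceColumn (replaceColumn M c x) d y ≋ replaceColumn (replaceColumn M d y) c x
  replaceColumn-comm M {c} {d} x y c≢d i j with j Fin.≟ c | j Fin.≟ d
  ... | yes ≡.refl | yes ≡.refl = ⊥-elim (c≢d ≡.refl)
  ... | yes ≡.refl | no j≢d = begin
    replaceColumn (replaceColumn M c x) d y i j ≡⟨ replaceColumn-off (replaceColumn M c x) d y i j j≢d ⟩
    replaceColumn M c x i j                     ≡⟨ replaceColumn-at M c x i ⟩
    x i                                         ≡⟨ replaceColumn-at (replaceColumn M d y) c x i ⟨
    replaceColumn (replaceColumn M d y) c x i j ∎
  ... | no j≢c | yes ≡.refl = begin
    replaceColumn (replaceColumn M c x) d y i j ≡⟨ replaceColumn-at (replaceColumn M c x) d y i ⟩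
    y i                                         ≡⟨ replaceColumn-at M d y i ⟨
    replaceColumn M d y i j                     ≡⟨ replaceColumn-off (replaceColumn M d y) c x i j j≢c ⟨
    replaceColumn (replaceColumn M d y) c x i j ∎
  ... | no j≢c | no j≢d = begin
    replaceColumn (replaceColumn M c x) d y i j ≡⟨ replaceColumn-off (replaceColumn M c x) d y i j j≢d ⟩
    replaceColumn M c x i j                     ≡⟨ replaceColumn-off M c x i j j≢c ⟩
    M i j                                       ≡⟨ replaceColumn-off M d y i j j≢d ⟨
    replaceColumn M d y i j                     ≡⟨ replaceColumn-off (replaceColumn M d y) c x i j j≢c ⟨
    replaceColumn (replaceColumn M d y) c x i j ∎

  det-replaceColumn-linear : ∀ {n} (M : Mat R n n) c a b x y →
    det R (replaceColumn M c (λ i → a * x i + b * y i)) ≈ a * det R (replaceColumn M c x) + b * det R (replaceColumn M c y)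
  det-replaceColumn-linear M c a b x y = det-linear-column c a b (replaceColumn M c x) (replaceColumn M c y) (replaceColumn M c (λ i → a * x i + b * y i)) at-c
    (λ i j j≢c → reflexive (≡.trans (replaceColumn-off M c (λ i → a * x i + b * y i) i j j≢c) (≡.sym (replaceColumn-off M c x i j j≢c))))
    (λ i j j≢c → reflexive (≡.trans (replaceColumn-off M c y i j j≢c) (≡.sym (replaceColumn-off M c x i j j≢c))))
    where
    at-c : ∀ i → replaceColumn M c (λ i → a * x i + b * y i) i c ≈ a * replaceColumn M c x i c + b * replaceColumn M c y i c
    at-c i rewrite replaceColumn-at M c (λ i → a * x i + b * y i) i | replaceColumn-at M c x i | replaceColumn-at M c y i = refl

  det-replaceColumn-+ : ∀ {n} (M : Mat R n n) c x y →
    det R (replaceColumn M c (λ i → x i + y i)) ≈ det R (replaceColumn M c x) + det R (replaceColumn M c y)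
  det-replaceColumn-+ M c x y = begin
    det R (replaceColumn M c (λ i → x i + y i))
      ≈⟨ det-cong (replaceColumn-cong M c (λ i → sym (+-cong (*-identityˡ (x i)) (*-identityˡ (y i))))) ⟩
    det R (replaceColumn M c (λ i → 1# * x i + 1# * y i))
      ≈⟨ det-replaceColumn-linear M c 1# 1# x y ⟩
    1# * det R (replaceColumn M c x) + 1# * det R (replaceColumn M c y)
      ≈⟨ +-cong (*-identityˡ _) (*-identityˡ _) ⟩
    det R (replaceColumn M c x) + det R (replaceColumn M c y) ∎

  swapColumns : ∀ {n} → Mat R n n → Fin n → Fin n → Mat R n n
  swapColumns M c d = replaceColumn (replaceColumn M c (λ r → M r d)) d (λ r → M r c)

  det-swap-adjacent-columns : ∀ {n} (M : Mat R (suc n) (suc n)) (i : Fin n) →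
    det R (swapColumns M (inject₁ i) (suc i)) ≈ - det R M
  -- With G x y = M with the two columns set to x and y: by bilinearity, 0 = det (G (u + v) (u + v))
  -- splits into det (G u v) + det (G v u) plus two determinants with equal columns.
  det-swap-adjacent-columns M i = +-inverseʳ-unique (det R M) (det R (G v u)) (begin
    det R M + det R (G v u)                       ≈⟨ +-cong (sym (+-identityˡ _)) (sym (+-identityʳ _)) ⟩
    (0# + det R M) + (det R (G v u) + 0#)         ≈⟨ sym (+-cong (+-cong (G-diagonal u) (det-cong G-u-v≋M)) (+-congˡ (G-diagonal v))) ⟩
    (det R (G u u) + det R (G u v)) + (det R (G v u) + det R (G v v))
      ≈⟨ sym (+-cong (det-replaceColumn-+ (G₀ u) (suc i) u v) (det-replaceColumn-+ (G₀ v) (suc i) u v)) ⟩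
    det R (G u s) + det R (G v s)                 ≈⟨ sym (G-additiveˡ u v s) ⟩
    det R (G s s)                                 ≈⟨ G-diagonal s ⟩
    0#                                            ∎)
    where
    u v s : Fin _ → Carrier
    u r = M r (inject₁ i)
    v r = M r (suc i)
    s r = u r + v r
    G₀ : (Fin _ → Carrier) → Mat R _ _
    G₀ x = replaceColumn M (inject₁ i) x
    G : (Fin _ → Carrier) → (Fin _ → Carrier) → Mat R _ _
    G x y = replaceColumn (G₀ x) (suc i) y
    G-at-inject₁ : ∀ x y r → G x y r (inject₁ i) ≡ x r
    G-at-inject₁ x y r = ≡.trans (replaceColumn-off (G₀ x) (suc i) y r (inject₁ i) (inject₁≢suc i)) (replaceColumn-at M (inject₁ i) x r)
    G-diagonal : ∀ x → det R (G x x) ≈ 0#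
    G-diagonal x = det-adjacent-equal-columns (G x x) i
      (λ r → reflexive (≡.trans (G-at-inject₁ x x r) (≡.sym (replaceColumn-at (G₀ x) (suc i) x r))))
    G-u-v≋M : G u v ≋ M
    G-u-v≋M r j with j Fin.≟ (suc i)
    ... | yes ≡.refl = reflexive (replaceColumn-at (G₀ u) (suc i) v r)
    ... | no j≢si = trans (reflexive (replaceColumn-off (G₀ u) (suc i) v r j j≢si)) (replaceColumn-self M (inject₁ i) r j)
    G-additiveˡ : ∀ x y z → det R (G (λ r → x r + y r) z) ≈ det R (G x z) + det R (G y z)
    G-additiveˡ x y z = begin
      det R (G (λ r → x r + y r) z)
        ≈⟨ det-cong (replaceColumn-comm M (λ r → x r + y r) z (inject₁≢suc i)) ⟩
      det R (replaceColumn (replaceColumn M (suc i) z) (inject₁ i) (λ r → x r + y r))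
        ≈⟨ det-replaceColumn-+ (replaceColumn M (suc i) z) (inject₁ i) x y ⟩
      det R (replaceColumn (replaceColumn M (suc i) z) (inject₁ i) x) + det R (replaceColumn (replaceColumn M (suc i) z) (inject₁ i) y)
        ≈⟨ sym (+-cong (det-cong (replaceColumn-comm M x z (inject₁≢suc i))) (det-cong (replaceColumn-comm M y z (inject₁≢suc i)))) ⟩
      det R (G x z) + det R (G y z) ∎

  -- Induction on the gap g between the columns: an adjacent swap shrinks it by one.
  det-equal-columns-gap : ∀ g {n} (M : Mat R (suc n) (suc n)) (c : Fin (suc n)) (i : Fin n) →
    toℕ i ≡ g ℕ.+ toℕ c → (∀ r → M r c ≈ M r (suc i)) → det R M ≈ 0#
  det-equal-columns-gap zero M c i i≡c equal =
    det-adjacent-equal-columns M i (λ r → ≡.subst (λ x → M r x ≈ M r (suc i)) c≡inject₁i (equal r))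
    where
    c≡inject₁i : c ≡ inject₁ i
    c≡inject₁i = Fin.toℕ-injective (≡.trans (≡.sym i≡c) (≡.sym (Fin.toℕ-inject₁ i)))
  det-equal-columns-gap (suc g) {suc n} M c (suc i) i≡g+c equal = begin
    det R M         ≈⟨ sym (-‿involutive _) ⟩
    - - det R M     ≈⟨ -‿cong (sym (det-swap-adjacent-columns M (suc i))) ⟩
    - det R M′      ≈⟨ -‿cong (det-equal-columns-gap g M′ c (inject₁ i) gap equal′) ⟩
    - 0#            ≈⟨ -0#≈0# ⟩
    0#              ∎
    where
    M′ = swapColumns M (inject₁ (suc i)) (suc (suc i))
    gap : toℕ (inject₁ i) ≡ g ℕ.+ toℕ c
    gap = ≡.trans (Fin.toℕ-inject₁ i) (ℕ.suc-injective i≡g+c)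
    c<si : toℕ c ℕ.< toℕ (suc i)
    c<si = ≡.subst (toℕ c ℕ.<_) (≡.sym i≡g+c) (ℕ.s≤s (ℕ.m≤n+m (toℕ c) g))
    c≢inject₁si : c ≢ inject₁ (suc i)
    c≢inject₁si eq = ℕ.<-irrefl (≡.trans (≡.cong toℕ eq) (Fin.toℕ-inject₁ (suc i))) c<si
    equal′ : ∀ r → M′ r c ≈ M′ r (suc (inject₁ i))
    equal′ r = begin
      M′ r c            ≡⟨ replaceColumn-off M₁ (suc (suc i)) u r c (Fin.<⇒≢ (ℕ.m<n⇒m<1+n c<si)) ⟩
      M₁ r c            ≡⟨ replaceColumn-off M (inject₁ (suc i)) v r c c≢inject₁si ⟩
      M r c             ≈⟨ equal r ⟩
      M r (suc (suc i)) ≡⟨ replaceColumn-at M (inject₁ (suc i)) v r ⟨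
      M₁ r (inject₁ (suc i)) ≡⟨ replaceColumn-off M₁ (suc (suc i)) u r (inject₁ (suc i)) (inject₁≢suc (suc i)) ⟨
      M′ r (suc (inject₁ i)) ∎
      where
      u = λ r → M r (inject₁ (suc i))
      v = λ r → M r (suc (suc i))
      M₁ = replaceColumn M (inject₁ (suc i)) v

  det-equal-columns-< : ∀ {n} (M : Mat R n n) {c d} → c Fin.< d → (∀ r → M r c ≈ M r d) → det R M ≈ 0#
  det-equal-columns-< {suc n} M {c} {suc i} (ℕ.s≤s c≤i) =
    det-equal-columns-gap (toℕ i ℕ.∸ toℕ c) M c i (≡.sym (ℕ.m∸n+n≡m c≤i))

  det-equal-columns : ∀ {n} (M : Mat R n n) {c d} → c ≢ d → (∀ r → M r c ≈ M r d) → det R M ≈ 0#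
  det-equal-columns M {c} {d} c≢d equal with Fin.<-cmp c d
  ... | tri< c<d _ _ = det-equal-columns-< M c<d equal
  ... | tri≈ _ c≡d _ = ⊥-elim (c≢d c≡d)
  ... | tri> _ _ d<c = det-equal-columns-< M d<c (λ r → sym (equal r))

  det-replaceColumn-sum : ∀ {n p} (M : Mat R n n) c (α : Fin p → Carrier) (x : Fin p → Fin n → Carrier) →
    det R (replaceColumn M c (λ r → ∑[ w < p ] (α w * x w r))) ≈ ∑[ w < p ] (α w * det R (replaceColumn M c (x w)))
  det-replaceColumn-sum {p = zero} M c α x =
    det-zero-column (replaceColumn M c (λ _ → 0#)) c (λ r → reflexive (replaceColumn-at M c (λ _ → 0#) r))
  det-replaceColumn-sum {p = suc p} M c α x = begin
    det R (replaceColumn M c (λ r → α zero * x zero r + rest r))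
      ≈⟨ det-cong (replaceColumn-cong M c (λ r → +-congˡ (sym (*-identityˡ (rest r))))) ⟩
    det R (replaceColumn M c (λ r → α zero * x zero r + 1# * rest r))
      ≈⟨ det-replaceColumn-linear M c (α zero) 1# (x zero) rest ⟩
    α zero * det R (replaceColumn M c (x zero)) + 1# * det R (replaceColumn M c rest)
      ≈⟨ +-congˡ (trans (*-identityˡ _) (det-replaceColumn-sum M c (λ w → α (suc w)) (λ w → x (suc w)))) ⟩
    ∑[ w < suc p ] (α w * det R (replaceColumn M c (x w))) ∎
    where
    rest : Fin _ → Carrier
    rest r = ∑[ w < p ] (α (suc w) * x (suc w) r)

  det-add-to-column : ∀ {n p} (M : Mat R n n) c (σ : Fin p → Fin n) (α : Fin p → Carrier) → (∀ w → σ w ≢ c) →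
    det R (λ r j → M r j + idMat R j c * ∑[ w < p ] (α w * M r (σ w))) ≈ det R M
  det-add-to-column {n} {p} M c σ α σ≢c = begin
    det R (λ r j → M r j + idMat R j c * y r)                    ≈⟨ det-cong added≋replaced ⟩
    det R (replaceColumn M c (λ r → M r c + y r))                 ≈⟨ det-replaceColumn-+ M c (λ r → M r c) y ⟩
    det R (replaceColumn M c (λ r → M r c)) + det R (replaceColumn M c y)
      ≈⟨ +-cong (det-cong (replaceColumn-self M c)) (det-replaceColumn-sum M c α (λ w r → M r (σ w))) ⟩
    det R M + ∑[ w < p ] (α w * det R (replaceColumn M c (λ r → M r (σ w))))
      ≈⟨ +-congˡ (sum-zero (λ w → trans (*-congˡ (copy-is-singular w)) (zeroʳ (α w)))) ⟩
    det R M + 0#                                                  ≈⟨ +-identityʳ _ ⟩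
    det R M                                                       ∎
    where
    y : Fin n → Carrier
    y r = ∑[ w < p ] (α w * M r (σ w))
    added≋replaced : (λ r j → M r j + idMat R j c * y r) ≋ replaceColumn M c (λ r → M r c + y r)
    added≋replaced r j with j Fin.≟ c
    ... | yes ≡.refl = trans (+-congˡ (*-identityˡ (y r)))
                             (sym (reflexive (replaceColumn-at M c (λ r → M r c + y r) r)))
    ... | no j≢c = trans (+-congˡ (zeroˡ (y r)))
                         (trans (+-identityʳ (M r j)) (sym (reflexive (replaceColumn-off M c (λ r → M r c + y r) r j j≢c))))
    copy-is-singular : ∀ w → det R (replaceColumn M c (λ r → M r (σ w))) ≈ 0#
    copy-is-singular w = det-equal-columns _ (σ≢c w ∘ ≡.sym) (λ r → reflexive
      (≡.trans (replaceColumn-at M c (λ r → M r (σ w)) r) (≡.sym (replaceColumn-off M c (λ r → M r (σ w)) r (σ w) (σ≢c w)))))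

  det-add-to-columns : ∀ {n k p} (M : Mat R n n) (τ : Fin k → Fin n) (σ : Fin p → Fin n) (α : Fin k → Fin p → Carrier) →
    (∀ u w → σ w ≢ τ u) →
    det R (λ r j → M r j + ∑[ u < k ] (idMat R j (τ u) * ∑[ w < p ] (α u w * M r (σ w)))) ≈ det R M
  det-add-to-columns {k = zero} M τ σ α σ≢τ = det-cong (λ r j → +-identityʳ (M r j))
  det-add-to-columns {n} {suc k} {p} M τ σ α σ≢τ = begin
    det R (λ r j → M r j + (idMat R j (τ zero) * Y zero r + later r j))
      ≈⟨ det-cong first-added-last ⟩
    det R (λ r j → N r j + idMat R j (τ zero) * ∑[ w < p ] (α zero w * N r (σ w)))
      ≈⟨ det-add-to-column N (τ zero) σ (α zero) (λ w → σ≢τ zero w) ⟩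
    det R N
      ≈⟨ det-add-to-columns M (λ u → τ (suc u)) σ (λ u → α (suc u)) (λ u → σ≢τ (suc u)) ⟩
    det R M ∎
    where
    Y : Fin (suc k) → Fin n → Carrier
    Y u r = ∑[ w < p ] (α u w * M r (σ w))
    later : Fin n → Fin n → Carrier
    later r j = ∑[ u < k ] (idMat R j (τ (suc u)) * Y (suc u) r)
    N : Mat R n n
    N r j = M r j + later r j
    N-at-source : ∀ r w → N r (σ w) ≈ M r (σ w)
    N-at-source r w = trans (+-congˡ (sum-zero (λ u → trans (*-congʳ (idMat-off (σ≢τ (suc u) w))) (zeroˡ _))))
                            (+-identityʳ _)
    first-added-last : (λ r j → M r j + (idMat R j (τ zero) * Y zero r + later r j))
                     ≋ (λ r j → N r j + idMat R j (τ zero) * ∑[ w < p ] (α zero w * N r (σ w)))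
    first-added-last r j = begin
      M r j + (idMat R j (τ zero) * Y zero r + later r j)
        ≈⟨ solve 3 (λ m a l → m :+ (a :+ l) := (m :+ l) :+ a) refl (M r j) _ (later r j) ⟩
      N r j + idMat R j (τ zero) * Y zero r
        ≈⟨ +-congˡ (*-congˡ (sum-cong-≋ (λ w → *-congˡ (sym (N-at-source r w))))) ⟩
      N r j + idMat R j (τ zero) * ∑[ w < p ] (α zero w * N r (σ w)) ∎

  det-zero-block : ∀ {n} k (M : Mat R n n) → k ℕ.< n →
    (∀ i j → k ℕ.≤ toℕ i → toℕ j ℕ.≤ k → M i j ≈ 0#) → det R M ≈ 0#
  det-zero-block {suc n} zero M _ zeros = det-zero-column M zero (λ i → zeros i zero ℕ.z≤n ℕ.z≤n)
  det-zero-block {suc n} (suc k) M (ℕ.s≤s k<n) zeros = begin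
    det R M             ≡⟨ det-expand M ⟩
    sum (laplaceTerm M) ≈⟨ sum-zero (λ j → laplaceTerm-zero M j (minor-zero j)) ⟩
    0#                  ∎
    where
    minor-zero : ∀ j → det R (minor M j) ≈ 0#
    minor-zero j = det-zero-block k (minor M j) k<n
      (λ i l k≤i l≤k → zeros (suc i) (punchIn j l) (ℕ.s≤s k≤i) (ℕ.≤-trans (toℕ-punchIn-≤ j l) (ℕ.s≤s l≤k)))

  -- Expanding along a column of the right block leaves a minor whose zero block is one column too wide.
  laplaceTerm-right-block-zero : ∀ a {b} (M : Mat R (suc a ℕ.+ b) (suc a ℕ.+ b)) →
    (∀ i j → M (suc a ↑ʳ i) (j ↑ˡ b) ≈ 0#) → ∀ w → laplaceTerm M (suc a ↑ʳ w) ≈ 0#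
  laplaceTerm-right-block-zero a {b} M lower-zero w =
    laplaceTerm-zero M j (det-zero-block a (minor M j) (ℕ.m<m+n a (ℕ.m<n⇒0<n (Fin.toℕ<n w))) block)
    where
    j = suc a ↑ʳ w
    block : ∀ i l → a ℕ.≤ toℕ i → toℕ l ℕ.≤ a → M (suc i) (punchIn j l) ≈ 0#
    block i l a≤i l≤a = ≡.subst₂ (λ x y → M x y ≈ 0#)
      (≡.sym (↑ʳ-of-≥ (suc a) (suc i) (ℕ.s≤s a≤i))) (≡.sym (↑ˡ-of-< (suc a) (punchIn j l) column-left))
      (lower-zero _ _)
      where
      l<j : toℕ l ℕ.< toℕ j
      l<j = ℕ.≤-trans (ℕ.s≤s l≤a) (ℕ.≤-trans (ℕ.m≤m+n (suc a) (toℕ w)) (ℕ.≤-reflexive (≡.sym (Fin.toℕ-↑ʳ (suc a) w))))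
      column-left : toℕ (punchIn j l) ℕ.< suc a
      column-left = ≡.subst (ℕ._< suc a) (≡.sym (toℕ-punchIn-< j l l<j)) (ℕ.s≤s l≤a)

  det-block-triangular : ∀ a {b} (M : Mat R (a ℕ.+ b) (a ℕ.+ b)) → (∀ i j → M (a ↑ʳ i) (j ↑ˡ b) ≈ 0#) →
    det R M ≈ det R (λ i j → M (i ↑ˡ b) (j ↑ˡ b)) * det R (λ i j → M (a ↑ʳ i) (a ↑ʳ j))
  det-block-triangular zero    M _ = sym (*-identityˡ _)
  det-block-triangular (suc a) {b} M lower-zero = begin
    det R M
      ≡⟨ det-expand M ⟩
    sum (laplaceTerm M)
      ≈⟨ sum-↑ (suc a) (laplaceTerm M) ⟩
    ∑[ u < suc a ] laplaceTerm M (u ↑ˡ b) + ∑[ w < b ] laplaceTerm M (suc a ↑ʳ w)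
      ≈⟨ +-cong (sum-cong-≋ left-term) (sum-zero (laplaceTerm-right-block-zero a M lower-zero)) ⟩
    ∑[ u < suc a ] (laplaceTerm TL u * det R BR) + 0#
      ≈⟨ +-identityʳ _ ⟩
    ∑[ u < suc a ] (laplaceTerm TL u * det R BR)
      ≈⟨ sym (*-distribʳ-sum (det R BR) (laplaceTerm TL)) ⟩
    sum (laplaceTerm TL) * det R BR
      ≡⟨ ≡.cong (_* det R BR) (det-expand TL) ⟨
    det R TL * det R BR ∎
    where
    TL : Mat R (suc a) (suc a)
    TL i j = M (i ↑ˡ b) (j ↑ˡ b)
    BR : Mat R b b
    BR i j = M (suc a ↑ʳ i) (suc a ↑ʳ j)
    left-term : ∀ u → laplaceTerm M (u ↑ˡ b) ≈ laplaceTerm TL u * det R BR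
    left-term u = begin
      sgn R (toℕ (u ↑ˡ b)) * (M zero (u ↑ˡ b) * det R (minor M (u ↑ˡ b)))
        ≡⟨ ≡.cong (λ t → sgn R t * (TL zero u * det R (minor M (u ↑ˡ b)))) (Fin.toℕ-↑ˡ u b) ⟩
      sgn R (toℕ u) * (TL zero u * det R (minor M (u ↑ˡ b)))
        ≈⟨ *-congˡ (*-congˡ minor-splits) ⟩
      sgn R (toℕ u) * (TL zero u * (det R (minor TL u) * det R BR))
        ≈⟨ solve 4 (λ s x d e → s :* (x :* (d :* e)) := (s :* (x :* d)) :* e) refl _ _ _ _ ⟩
      laplaceTerm TL u * det R BR ∎
      where
      minor-splits : det R (minor M (u ↑ˡ b)) ≈ det R (minor TL u) * det R BR
      minor-splits = trans
        (det-block-triangular a (minor M (u ↑ˡ b))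
          (λ i j → trans (reflexive (≡.cong (M (suc a ↑ʳ i)) (punchIn-↑ˡ b u j))) (lower-zero i (punchIn u j))))
        (*-cong (det-cong (λ i j → reflexive (≡.cong (M (suc (i ↑ˡ b))) (punchIn-↑ˡ b u j))))
                (det-cong (λ i j → reflexive (≡.cong (M (suc a ↑ʳ i)) (punchIn-↑ˡ-↑ʳ a u j)))))

  det-scale : ∀ {n} s (M : Mat R n n) → det R (λ i j → s * M i j) ≈ pow R s n * det R M
  det-scale {zero}  s M = sym (*-identityˡ _)
  det-scale {suc n} s M = begin
    det R sM                                     ≡⟨ det-expand sM ⟩
    sum (laplaceTerm sM)                         ≈⟨ sum-cong-≋ term ⟩
    ∑[ j < suc n ] (s * pow R s n * laplaceTerm M j) ≈⟨ sym (*-distribˡ-sum (s * pow R s n) (laplaceTerm M)) ⟩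
    s * pow R s n * sum (laplaceTerm M)          ≡⟨ ≡.cong (s * pow R s n *_) (det-expand M) ⟨
    s * pow R s n * det R M                      ∎
    where
    sM : Mat R (suc n) (suc n)
    sM i j = s * M i j
    term : ∀ j → laplaceTerm sM j ≈ s * pow R s n * laplaceTerm M j
    term j = trans (*-congˡ (*-congˡ (det-scale s (minor M j))))
      (solve 5 (λ g s m p d → g :* ((s :* m) :* (p :* d)) := (s :* p) :* (g :* (m :* d))) refl _ _ _ _ _)

  blockEntry : ∀ {m n} → Mat R n n → Fin m × Fin n → Fin m × Fin n → Carrier
  blockEntry Z (k , w) (k′ , w′) = idMat R k k′ * Z w w′

  blockDiagonal : ∀ m {n} → Mat R n n → Mat R (m ℕ.* n) (m ℕ.* n)
  blockDiagonal m {n} Z p q = blockEntry Z (remQuot {m} n p) (remQuot {m} n q)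

  sum-blockDiagonal : ∀ m {n} (Z : Mat R n n) (p : Fin (m ℕ.* n)) (g : Fin (m ℕ.* n) → Carrier) →
    ∑[ q < m ℕ.* n ] (blockDiagonal m Z p q * g q) ≈ ∑[ w < n ] (Z (remainder {m} n p) w * g (combine (quotient {m} n p) w))
  sum-blockDiagonal m {n} Z p g = begin
    ∑[ q < m ℕ.* n ] (blockDiagonal m Z p q * g q)
      ≈⟨ sum-combine m _ ⟩
    ∑[ k < m ] ∑[ w < n ] (blockDiagonal m Z p (combine k w) * g (combine k w))
      ≈⟨ sum-cong-≋ (λ k → trans (sum-cong-≋ (λ w → entry k w)) (sym (*-distribˡ-sum _ (λ w → Z (remainder {m} n p) w * g (combine k w))))) ⟩
    ∑[ k < m ] (idMat R (quotient {m} n p) k * ∑[ w < n ] (Z (remainder {m} n p) w * g (combine k w)))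
      ≈⟨ sum-idMatˡ (quotient {m} n p) (λ k → ∑[ w < n ] (Z (remainder {m} n p) w * g (combine k w))) ⟩
    ∑[ w < n ] (Z (remainder {m} n p) w * g (combine (quotient {m} n p) w)) ∎
    where
    entry : ∀ k w → blockDiagonal m Z p (combine k w) * g (combine k w)
                  ≈ idMat R (quotient {m} n p) k * (Z (remainder {m} n p) w * g (combine k w))
    entry k w = trans (*-congʳ (reflexive (≡.cong (blockEntry Z (remQuot {m} n p)) (Fin.remQuot-combine k w))))
                      (*-assoc _ _ _)

  det-blockDiagonal : ∀ m {n} (Z : Mat R n n) → det R (blockDiagonal m Z) ≈ pow R (det R Z) m
  det-blockDiagonal zero    Z = refl
  det-blockDiagonal (suc m) {n} Z = begin
    det R (blockDiagonal (suc m) Z)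
      ≈⟨ det-block-triangular n (blockDiagonal (suc m) Z) lower-zero ⟩
    det R (λ i j → blockDiagonal (suc m) Z (i ↑ˡ m ℕ.* n) (j ↑ˡ m ℕ.* n)) * det R (λ i j → blockDiagonal (suc m) Z (n ↑ʳ i) (n ↑ʳ j))
      ≈⟨ *-cong (det-cong first-block) (trans (det-cong other-blocks) (det-blockDiagonal m Z)) ⟩
    det R Z * pow R (det R Z) m ∎
    where
    lower-zero : ∀ i j → blockDiagonal (suc m) Z (n ↑ʳ i) (j ↑ˡ m ℕ.* n) ≈ 0#
    lower-zero i j = trans (reflexive (≡.cong₂ (blockEntry Z) (remQuot-↑ʳ n i) (Fin.remQuot-combine zero j))) (zeroˡ _)
    first-block : ∀ i j → blockDiagonal (suc m) Z (i ↑ˡ m ℕ.* n) (j ↑ˡ m ℕ.* n) ≈ Z i j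
    first-block i j = trans (reflexive (≡.cong₂ (blockEntry Z) (Fin.remQuot-combine zero i) (Fin.remQuot-combine zero j)))
                            (*-identityˡ _)
    other-blocks : ∀ i j → blockDiagonal (suc m) Z (n ↑ʳ i) (n ↑ʳ j) ≈ blockDiagonal m Z i j
    other-blocks i j = trans (reflexive (≡.cong₂ (blockEntry Z) (remQuot-↑ʳ n i) (remQuot-↑ʳ n j)))
                             (*-congʳ (idMat-suc (quotient {m} n i) (quotient {m} n j)))

-- The matrix [[X, −T′], [−F′, diag(Z, …, Z)]] with m copies of Z, where the column of T′ (row of F′)
-- indexed by a position in the k-th copy of Z is T k (F k).
module SchurComplement {c ℓ : Level} (R : CommutativeRing c ℓ) {n₁ m n₂ : ℕ}
  (X : Mat R n₁ n₁) (T F : Fin m → Fin n₁ → CommutativeRing.Carrier R) (Z N : Mat R n₂ n₂)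
  (Z⊗N≈I : IsInverse R Z N) where
  open CommutativeRing R hiding (zero)
  open Summation R
  open Determinant R
  open import Algebra.Properties.Ring ring using (-‿distribʳ-*)
  open import Algebra.Solver.Ring.NaturalCoefficients.Default commutativeSemiring using (solve; _:*_; _:=_)
  open import Relation.Binary.Reasoning.Setoid setoid

  private
    b = m ℕ.* n₂

  block : Fin n₁ ⊎ Fin b → Fin n₁ ⊎ Fin b → Carrier
  block (inj₁ s) (inj₁ u) = X s u
  block (inj₁ s) (inj₂ q) = 0# - T (quotient n₂ q) s
  block (inj₂ p) (inj₁ u) = 0# - F (quotient n₂ p) u
  block (inj₂ p) (inj₂ q) = blockDiagonal m Z p q

  blockMatrix : Mat R (n₁ ℕ.+ b) (n₁ ℕ.+ b)
  blockMatrix i j = block (splitAt n₁ i) (splitAt n₁ j)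

  schurComplement : Mat R n₁ n₁
  schurComplement s u = X s u - coronalOf R N * ∑[ k < m ] (T k s * F k u)

  blockMatrix-join : ∀ x y → blockMatrix (Fin.join n₁ b x) (Fin.join n₁ b y) ≡ block x y
  blockMatrix-join x y = ≡.cong₂ block (Fin.splitAt-join n₁ b x) (Fin.splitAt-join n₁ b y)

  ρ : Fin n₂ → Carrier
  ρ w = ∑[ w′ < n₂ ] N w w′

  Zρ≈1 : ∀ w₀ → ∑[ w < n₂ ] (Z w₀ w * ρ w) ≈ 1#
  Zρ≈1 w₀ = begin
    ∑[ w < n₂ ] (Z w₀ w * ρ w)                ≈⟨ sum-cong-≋ (λ w → *-distribˡ-sum (Z w₀ w) (N w)) ⟩
    ∑[ w < n₂ ] ∑[ w′ < n₂ ] (Z w₀ w * N w w′) ≈⟨ ∑-comm (λ w w′ → Z w₀ w * N w w′) ⟩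
    ∑[ w′ < n₂ ] ∑[ w < n₂ ] (Z w₀ w * N w w′) ≈⟨ sum-cong-≋ (λ w′ → trans (reflexive (≡.sym (Σ≡sum n₂ _))) (Z⊗N≈I w₀ w′)) ⟩
    ∑[ w′ < n₂ ] idMat R w₀ w′                 ≈⟨ sum-single (idMat R w₀) w₀ (λ w′ w′≢w₀ → idMat-off (w′≢w₀ ∘ ≡.sym)) ⟩
    idMat R w₀ w₀                              ≈⟨ idMat-diag w₀ ⟩
    1#                                         ∎

  coronal≈sumρ : coronalOf R N ≈ sum ρ
  coronal≈sumρ = trans (reflexive (Σ≡sum n₂ _)) (sum-cong-≋ (λ w → reflexive (Σ≡sum n₂ (N w))))

  -- Adding α u · (columns of the copies) to column u clears the block −F below X.
  α : Fin n₁ → Fin b → Carrier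
  α u q = F (quotient {m} n₂ q) u * ρ (remainder {m} n₂ q)

  α-combine : ∀ u k w → α u (combine k w) ≡ F k u * ρ w
  α-combine u k w = ≡.cong (λ kw → F (proj₁ kw) u * ρ (proj₂ kw)) (Fin.remQuot-combine k w)

  correction : Fin n₁ → Fin (n₁ ℕ.+ b) → Carrier
  correction u r = ∑[ q < b ] (α u q * blockMatrix r (n₁ ↑ʳ q))

  addedColumns : Mat R (n₁ ℕ.+ b) (n₁ ℕ.+ b)
  addedColumns r j = blockMatrix r j + ∑[ u < n₁ ] (idMat R j (u ↑ˡ b) * correction u r)

  added-at-left : ∀ u (y : Fin n₁ → Carrier) → ∑[ u′ < n₁ ] (idMat R (u ↑ˡ b) (u′ ↑ˡ b) * y u′) ≈ y u
  added-at-left u y = begin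
    ∑[ u′ < n₁ ] (idMat R (u ↑ˡ b) (u′ ↑ˡ b) * y u′)
      ≈⟨ sum-single (λ u′ → idMat R (u ↑ˡ b) (u′ ↑ˡ b) * y u′) u (λ u′ u′≢u → trans (*-congʳ (idMat-off (u′≢u ∘ ≡.sym ∘ Fin.↑ˡ-injective b u u′))) (zeroˡ _)) ⟩
    idMat R (u ↑ˡ b) (u ↑ˡ b) * y u ≈⟨ trans (*-congʳ (idMat-diag (u ↑ˡ b))) (*-identityˡ (y u)) ⟩
    y u ∎

  added-at-right : ∀ q (y : Fin n₁ → Carrier) → ∑[ u′ < n₁ ] (idMat R (n₁ ↑ʳ q) (u′ ↑ˡ b) * y u′) ≈ 0#
  added-at-right q y = sum-zero (λ u′ → trans (*-congʳ (idMat-off (↑ʳ≢↑ˡ n₁ q u′))) (zeroˡ (y u′)))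

  correction-bottom : ∀ u p → correction u (n₁ ↑ʳ p) ≈ F (quotient {m} n₂ p) u
  correction-bottom u p = begin
    ∑[ q < b ] (α u q * blockMatrix (n₁ ↑ʳ p) (n₁ ↑ʳ q))
      ≈⟨ sum-cong-≋ (λ q → trans (*-congˡ (reflexive (blockMatrix-join (inj₂ p) (inj₂ q)))) (*-comm _ _)) ⟩
    ∑[ q < b ] (blockDiagonal m Z p q * α u q)
      ≈⟨ sum-blockDiagonal m Z p (α u) ⟩
    ∑[ w < n₂ ] (Z (remainder {m} n₂ p) w * α u (combine k w))
      ≈⟨ sum-cong-≋ (λ w → trans (*-congˡ (reflexive (α-combine u k w)))
           (solve 3 (λ z f r → z :* (f :* r) := f :* (z :* r)) refl (Z (remainder {m} n₂ p) w) (F k u) (ρ w))) ⟩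
    ∑[ w < n₂ ] (F k u * (Z (remainder {m} n₂ p) w * ρ w))
      ≈⟨ sym (*-distribˡ-sum (F k u) (λ w → Z (remainder {m} n₂ p) w * ρ w)) ⟩
    F k u * ∑[ w < n₂ ] (Z (remainder {m} n₂ p) w * ρ w)
      ≈⟨ trans (*-congˡ (Zρ≈1 (remainder {m} n₂ p))) (*-identityʳ (F k u)) ⟩
    F k u ∎
    where k = quotient {m} n₂ p

  correction-top : ∀ u s → correction u (s ↑ˡ b) ≈ - (coronalOf R N * ∑[ k < m ] (T k s * F k u))
  correction-top u s = begin
    ∑[ q < b ] (α u q * blockMatrix (s ↑ˡ b) (n₁ ↑ʳ q))
      ≈⟨ sum-cong-≋ (λ q → *-congˡ (reflexive (blockMatrix-join (inj₁ s) (inj₂ q)))) ⟩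
    ∑[ q < b ] (α u q * (0# - T (quotient {m} n₂ q) s))
      ≈⟨ sum-combine m (λ q → α u q * (0# - T (quotient {m} n₂ q) s)) ⟩
    ∑[ k < m ] ∑[ w < n₂ ] (α u (combine k w) * (0# - T (quotient {m} n₂ (combine k w)) s))
      ≈⟨ sum-cong-≋ (λ k → sum-cong-≋ (λ w → term k w)) ⟩
    ∑[ k < m ] ∑[ w < n₂ ] (ρ w * - (T k s * F k u))
      ≈⟨ sum-cong-≋ (λ k → sym (*-distribʳ-sum (- (T k s * F k u)) ρ)) ⟩
    ∑[ k < m ] (sum ρ * - (T k s * F k u))
      ≈⟨ sym (*-distribˡ-sum (sum ρ) (λ k → - (T k s * F k u))) ⟩
    sum ρ * ∑[ k < m ] (- (T k s * F k u))
      ≈⟨ *-cong (sym coronal≈sumρ) (sum-neg (λ k → T k s * F k u)) ⟩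
    coronalOf R N * - ∑[ k < m ] (T k s * F k u)
      ≈⟨ sym (-‿distribʳ-* _ _) ⟩
    - (coronalOf R N * ∑[ k < m ] (T k s * F k u)) ∎
    where
    term : ∀ k w → α u (combine k w) * (0# - T (quotient {m} n₂ (combine k w)) s) ≈ ρ w * - (T k s * F k u)
    term k w = begin
      α u (combine k w) * (0# - T (quotient {m} n₂ (combine k w)) s)
        ≡⟨ ≡.cong₂ _*_ (α-combine u k w) (≡.cong (λ k′ → 0# - T k′ s) (≡.cong proj₁ (Fin.remQuot-combine k w))) ⟩
      F k u * ρ w * (0# - T k s)  ≈⟨ *-congˡ (+-identityˡ _) ⟩
      F k u * ρ w * - T k s       ≈⟨ sym (-‿distribʳ-* _ _) ⟩
      - (F k u * ρ w * T k s)     ≈⟨ -‿cong (solve 3 (λ f r t → f :* r :* t := r :* (t :* f)) refl (F k u) (ρ w) (T k s)) ⟩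
      - (ρ w * (T k s * F k u))   ≈⟨ -‿distribʳ-* _ _ ⟩
      ρ w * - (T k s * F k u)     ∎

  det-blockMatrix : det R blockMatrix ≈ pow R (det R Z) m * det R schurComplement
  det-blockMatrix = begin
    det R blockMatrix
      ≈⟨ sym (det-add-to-columns blockMatrix (_↑ˡ b) (n₁ ↑ʳ_) α (λ u q → ↑ʳ≢↑ˡ n₁ q u)) ⟩
    det R addedColumns
      ≈⟨ det-block-triangular n₁ addedColumns lower-left ⟩
    det R (λ s u → addedColumns (s ↑ˡ b) (u ↑ˡ b)) * det R (λ p q → addedColumns (n₁ ↑ʳ p) (n₁ ↑ʳ q))
      ≈⟨ *-cong (det-cong upper-left) (trans (det-cong lower-right) (det-blockDiagonal m Z)) ⟩
    det R schurComplement * pow R (det R Z) m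
      ≈⟨ *-comm _ _ ⟩
    pow R (det R Z) m * det R schurComplement ∎
    where
    lower-left : ∀ p u → addedColumns (n₁ ↑ʳ p) (u ↑ˡ b) ≈ 0#
    lower-left p u = begin
      addedColumns (n₁ ↑ʳ p) (u ↑ˡ b)
        ≈⟨ +-cong (reflexive (blockMatrix-join (inj₂ p) (inj₁ u))) (added-at-left u (λ u′ → correction u′ (n₁ ↑ʳ p))) ⟩
      (0# - F (quotient {m} n₂ p) u) + correction u (n₁ ↑ʳ p)
        ≈⟨ +-cong (+-identityˡ _) (correction-bottom u p) ⟩
      - F (quotient {m} n₂ p) u + F (quotient {m} n₂ p) u
        ≈⟨ -‿inverseˡ _ ⟩
      0# ∎
    upper-left : ∀ s u → addedColumns (s ↑ˡ b) (u ↑ˡ b) ≈ schurComplement s u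
    upper-left s u = +-cong (reflexive (blockMatrix-join (inj₁ s) (inj₁ u)))
                            (trans (added-at-left u (λ u′ → correction u′ (s ↑ˡ b))) (correction-top u s))
    lower-right : ∀ p q → addedColumns (n₁ ↑ʳ p) (n₁ ↑ʳ q) ≈ blockDiagonal m Z p q
    lower-right p q = trans (+-cong (reflexive (blockMatrix-join (inj₂ p) (inj₂ q))) (added-at-right q (λ u′ → correction u′ (n₁ ↑ʳ p)))) (+-identityʳ _)

module IncidenceSums {c ℓ : Level} (R : CommutativeRing c ℓ) where
  open CommutativeRing R hiding (zero)
  open Summation R
  open import Algebra.Solver.Ring.NaturalCoefficients.Default commutativeSemiring using (solve; _:+_; _:*_; _:=_)
  open import Relation.Binary.Reasoning.Setoid setoid

  𝟙 : Bool → Carrier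
  𝟙 = ⟦_⟧ R

  listSum : ∀ {A : Set} → (A → Carrier) → List A → Carrier
  listSum g = List.foldr (λ x s → g x + s) 0#

  listSum-++ : ∀ {A : Set} (g : A → Carrier) xs ys → listSum g (xs ++ ys) ≈ listSum g xs + listSum g ys
  listSum-++ g []       ys = sym (+-identityˡ _)
  listSum-++ g (x ∷ xs) ys = trans (+-congˡ (listSum-++ g xs ys)) (sym (+-assoc _ _ _))

  listSum-concatMap : ∀ {A B : Set} (g : B → Carrier) (f : A → List B) xs →
    listSum g (concatMap f xs) ≈ listSum (listSum g ∘ f) xs
  listSum-concatMap g f []       = refl
  listSum-concatMap g f (x ∷ xs) = trans (listSum-++ g (f x) (concatMap f xs)) (+-congˡ (listSum-concatMap g f xs))

  listSum-tabulate : ∀ {A : Set} {n} (g : A → Carrier) (f : Fin n → A) → listSum g (tabulate f) ≈ sum (g ∘ f)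
  listSum-tabulate {n = zero}  g f = refl
  listSum-tabulate {n = suc n} g f = +-congˡ (listSum-tabulate g (λ k → f (suc k)))

  listSum-allFin : ∀ {n} (g : Fin n → Carrier) → listSum g (allFin n) ≈ sum g
  listSum-allFin g = listSum-tabulate g (λ k → k)

  sum-lookup : ∀ {A : Set} (xs : List A) (g : A → Carrier) → ∑[ k < length xs ] g (lookup xs k) ≈ listSum g xs
  sum-lookup []       g = refl
  sum-lookup (x ∷ xs) g = +-congˡ (sum-lookup xs g)

  -- Definitionally, arcs D = pairs (arc D) and uedges D = pairs (orderedEdge D).
  pairs : ∀ {n} → (Fin n → Fin n → Bool) → List (Fin n × Fin n)
  pairs {n} P = concatMap (λ u → concatMap (λ v → if P u v then [ (u , v) ] else []) (allFin n)) (allFin n)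

  sum-pairs : ∀ {n} (P : Fin n → Fin n → Bool) (g : Fin n × Fin n → Carrier) →
    ∑[ k < length (pairs P) ] g (lookup (pairs P) k) ≈ ∑[ u < n ] ∑[ v < n ] (𝟙 (P u v) * g (u , v))
  sum-pairs {n} P g = begin
    ∑[ k < length (pairs P) ] g (lookup (pairs P) k)  ≈⟨ sum-lookup (pairs P) g ⟩
    listSum g (pairs P)                              ≈⟨ listSum-concatMap g row (allFin n) ⟩
    listSum (λ u → listSum g (row u)) (allFin n)     ≈⟨ listSum-allFin (λ u → listSum g (row u)) ⟩
    ∑[ u < n ] listSum g (row u)                     ≈⟨ sum-cong-≋ (λ u → trans (listSum-concatMap g (entry u) (allFin n)) (listSum-allFin (λ v → listSum g (entry u v)))) ⟩
    ∑[ u < n ] ∑[ v < n ] listSum g (entry u v)      ≈⟨ sum-cong-≋ (λ u → sum-cong-≋ (λ v → single u v (P u v))) ⟩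
    ∑[ u < n ] ∑[ v < n ] (𝟙 (P u v) * g (u , v))  ∎
    where
    entry : Fin n → Fin n → List (Fin n × Fin n)
    entry u v = if P u v then [ (u , v) ] else []
    row : Fin n → List (Fin n × Fin n)
    row u = concatMap (entry u) (allFin n)
    single : ∀ u v b → listSum g (if b then [ (u , v) ] else []) ≈ 𝟙 b * g (u , v)
    single u v true  = trans (+-identityʳ _) (sym (*-identityˡ _))
    single u v false = sym (zeroˡ _)

  sum-sift₂ : ∀ {n} (h : Fin n → Fin n → Carrier) s u →
    ∑[ a < n ] ∑[ b < n ] (h a b * (idMat R s a * idMat R u b)) ≈ h s u
  sum-sift₂ {n} h s u = begin
    ∑[ a < n ] ∑[ b < n ] (h a b * (idMat R s a * idMat R u b))
      ≈⟨ sum-cong-≋ (λ a → trans (sum-cong-≋ (λ b → reorder (h a b) (idMat R s a) (idMat R u b)))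
                                 (sym (*-distribˡ-sum (idMat R s a) (λ b → idMat R u b * h a b)))) ⟩
    ∑[ a < n ] (idMat R s a * ∑[ b < n ] (idMat R u b * h a b))  ≈⟨ sum-idMatˡ s (λ a → ∑[ b < n ] (idMat R u b * h a b)) ⟩
    ∑[ b < n ] (idMat R u b * h s b)                              ≈⟨ sum-idMatˡ u (h s) ⟩
    h s u                                                         ∎
    where
    reorder : ∀ x y z → x * (y * z) ≈ y * (z * x)
    reorder = solve 3 (λ x y z → x :* (y :* z) := y :* (z :* x)) refl

  sum-arcs-forward : ∀ {n} (D : Digraph n) s u →
    ∑[ k < numArcs D ] (𝟙 (s == proj₁ (lookup (arcs D) k)) * 𝟙 (u == proj₂ (lookup (arcs D) k))) ≈ A R D s u
  sum-arcs-forward D s u = trans (sum-pairs (arc D) (λ p → 𝟙 (s == proj₁ p) * 𝟙 (u == proj₂ p)))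
                                 (sum-sift₂ (λ a b → 𝟙 (arc D a b)) s u)

  sum-arcs-backward : ∀ {n} (D : Digraph n) s u →
    ∑[ k < numArcs D ] (𝟙 (s == proj₂ (lookup (arcs D) k)) * 𝟙 (u == proj₁ (lookup (arcs D) k))) ≈ A R D u s
  sum-arcs-backward {n} D s u = begin
    ∑[ k < numArcs D ] (𝟙 (s == proj₂ (lookup (arcs D) k)) * 𝟙 (u == proj₁ (lookup (arcs D) k)))
      ≈⟨ sum-pairs (arc D) (λ p → 𝟙 (s == proj₂ p) * 𝟙 (u == proj₁ p)) ⟩
    ∑[ a < n ] ∑[ b < n ] (𝟙 (arc D a b) * (idMat R s b * idMat R u a))
      ≈⟨ sum-cong-≋ (λ a → sum-cong-≋ (λ b → *-congˡ (*-comm (idMat R s b) (idMat R u a)))) ⟩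
    ∑[ a < n ] ∑[ b < n ] (𝟙 (arc D a b) * (idMat R u a * idMat R s b))
      ≈⟨ sum-sift₂ (λ a b → 𝟙 (arc D a b)) u s ⟩
    A R D u s ∎

  or-indicator : ∀ {n} {a b : Fin n} (x : Fin n) → a ≢ b → 𝟙 ((x == a) ∨ (x == b)) ≈ idMat R x a + idMat R x b
  or-indicator {a = a} {b} x a≢b with x Fin.≟ a | x Fin.≟ b
  ... | yes ≡.refl | yes ≡.refl = ⊥-elim (a≢b ≡.refl)
  ... | yes _ | no _  = sym (+-identityʳ 1#)
  ... | no _  | yes _ = sym (+-identityˡ 1#)
  ... | no _  | no _  = sym (+-identityˡ 0#)

  orderedEdge : ∀ {n} → Digraph n → Fin n → Fin n → Bool
  orderedEdge D u v = (toℕ u <ᵇ toℕ v) ∧ uadj D u v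

  orderedEdge-symmetrize : ∀ {n} (D : Digraph n) x y → 𝟙 (orderedEdge D x y) + 𝟙 (orderedEdge D y x) ≈ 𝟙 (uadj D x y)
  orderedEdge-symmetrize D x y with toℕ x <ᵇ toℕ y in x<y | toℕ y <ᵇ toℕ x in y<x
  ... | true  | true  = ⊥-elim (ℕ.<-asym (<ᵇ≡true⇒< (toℕ x) (toℕ y) x<y) (<ᵇ≡true⇒< (toℕ y) (toℕ x) y<x))
  ... | true  | false = +-identityʳ _
  ... | false | true  = trans (+-identityˡ _) (reflexive (≡.cong 𝟙 (∨-comm (arc D y x) (arc D x y))))
  ... | false | false = trans (+-identityˡ 0#) (reflexive (≡.cong 𝟙 (≡.sym no-loop)))
    where
    x≡y : x ≡ y
    x≡y = Fin.toℕ-injective (ℕ.≤-antisym (ℕ.≮⇒≥ (<ᵇ≡false⇒≮ (toℕ y) (toℕ x) y<x)) (ℕ.≮⇒≥ (<ᵇ≡false⇒≮ (toℕ x) (toℕ y) x<y)))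
    no-loop : uadj D x y ≡ false
    no-loop rewrite x≡y | loopless D y = ≡.refl

  orderedEdge-term : ∀ {n} (D : Digraph n) s u a b →
    𝟙 (orderedEdge D a b) * (𝟙 ((s == a) ∨ (s == b)) * 𝟙 ((u == a) ∨ (u == b)))
      ≈ 𝟙 (orderedEdge D a b) * ((idMat R s a + idMat R s b) * (idMat R u a + idMat R u b))
  orderedEdge-term D s u a b with toℕ a <ᵇ toℕ b in a<b
  ... | false = trans (zeroˡ _) (sym (zeroˡ _))
  ... | true  = *-congˡ (*-cong (or-indicator s a≢b) (or-indicator u a≢b))
    where
    a≢b : a ≢ b
    a≢b a≡b = ℕ.<-irrefl (≡.cong toℕ a≡b) (<ᵇ≡true⇒< (toℕ a) (toℕ b) a<b)

  degree-on-diagonal : ∀ {n} (D : Digraph n) s u →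
    idMat R u s * ∑[ v < n ] 𝟙 (uadj D s v) ≈ (if s == u then degree R D s else 0#)
  degree-on-diagonal {n} D s u with s Fin.≟ u
  ... | yes ≡.refl = trans (*-congʳ (idMat-diag s)) (trans (*-identityˡ _) (reflexive (≡.sym (Σ≡sum n _))))
  ... | no s≢u     = trans (*-congʳ (idMat-off (s≢u ∘ ≡.sym))) (zeroˡ _)

  sum-edges : ∀ {n} (D : Digraph n) s u →
    ∑[ k < numEdges D ] (𝟙 ((s == proj₁ (lookup (uedges D) k)) ∨ (s == proj₂ (lookup (uedges D) k)))
                       * 𝟙 ((u == proj₁ (lookup (uedges D) k)) ∨ (u == proj₂ (lookup (uedges D) k))))
      ≈ Q R D s u
  sum-edges {n} D s u = begin
    _ ≈⟨ sum-pairs (orderedEdge D) (λ e → 𝟙 ((s == proj₁ e) ∨ (s == proj₂ e)) * 𝟙 ((u == proj₁ e) ∨ (u == proj₂ e))) ⟩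
    _ ≈⟨ sum-cong-≋ (λ a → sum-cong-≋ (λ b → trans (orderedEdge-term D s u a b) (*-congˡ (split a b)))) ⟩
    ∑[ a < n ] ∑[ b < n ] (𝟙 (orderedEdge D a b) * (g a b + g b a))
      ≈⟨ sum-symmetrize (λ a b → 𝟙 (orderedEdge D a b)) (λ a b → 𝟙 (uadj D a b)) g (orderedEdge-symmetrize D) ⟩
    ∑[ a < n ] ∑[ b < n ] (𝟙 (uadj D a b) * g a b)
      ≈⟨ sum-cong-≋ (λ a → trans (sum-cong-≋ (λ b → solve 3 (λ x y z → x :* (y :* z) := y :* (x :* z)) refl
                                    (𝟙 (uadj D a b)) (idMat R s a) (idMat R u a + idMat R u b)))
                                  (sym (*-distribˡ-sum (idMat R s a) (λ b → 𝟙 (uadj D a b) * (idMat R u a + idMat R u b))))) ⟩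
    ∑[ a < n ] (idMat R s a * ∑[ b < n ] (𝟙 (uadj D a b) * (idMat R u a + idMat R u b)))
      ≈⟨ sum-idMatˡ s (λ a → ∑[ b < n ] (𝟙 (uadj D a b) * (idMat R u a + idMat R u b))) ⟩
    ∑[ b < n ] (𝟙 (uadj D s b) * (idMat R u s + idMat R u b))
      ≈⟨ sum-cong-≋ (λ b → solve 3 (λ x y z → x :* (y :+ z) := y :* x :+ z :* x) refl (𝟙 (uadj D s b)) (idMat R u s) (idMat R u b)) ⟩
    ∑[ b < n ] (idMat R u s * 𝟙 (uadj D s b) + idMat R u b * 𝟙 (uadj D s b))
      ≈⟨ ∑-distrib-+ (λ b → idMat R u s * 𝟙 (uadj D s b)) (λ b → idMat R u b * 𝟙 (uadj D s b)) ⟩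
    ∑[ b < n ] (idMat R u s * 𝟙 (uadj D s b)) + ∑[ b < n ] (idMat R u b * 𝟙 (uadj D s b))
      ≈⟨ +-cong (sym (*-distribˡ-sum (idMat R u s) (λ b → 𝟙 (uadj D s b)))) (sum-idMatˡ u (λ b → 𝟙 (uadj D s b))) ⟩
    idMat R u s * ∑[ b < n ] 𝟙 (uadj D s b) + 𝟙 (uadj D s u)
      ≈⟨ +-congʳ (degree-on-diagonal D s u) ⟩
    Q R D s u ∎
    where
    g : Fin n → Fin n → Carrier
    g a b = idMat R s a * (idMat R u a + idMat R u b)
    split : ∀ a b → (idMat R s a + idMat R s b) * (idMat R u a + idMat R u b) ≈ g a b + g b a
    split a b = solve 4 (λ x y z w → (x :+ y) :* (z :+ w) := x :* (z :+ w) :+ y :* (w :+ z)) refl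
                  (idMat R s a) (idMat R s b) (idMat R u a) (idMat R u b)

module ArcCorona {c ℓ : Level} (R : CommutativeRing c ℓ) where
  open CommutativeRing R hiding (zero)
  open Summation R
  open Determinant R
  open IncidenceSums R using (𝟙; sum-arcs-forward; sum-arcs-backward; sum-edges)
  open import Algebra.Properties.Ring ring using (-‿+-comm; x[y-z]≈xy-xz)
  open import Relation.Binary.Reasoning.Setoid setoid

  module _ {n₁ n₂ m : ℕ} (D₁ : Digraph n₁) (D₂ : Digraph n₂) (toW fromW : Fin m → Fin n₁ → Bool)
           (λ' : Carrier) (N : Mat R n₂ n₂) (inv : IsInverse R (charMat R λ' (A R D₂)) N) where
    open SchurComplement R (charMat R λ' (A R D₁)) (λ k u → 𝟙 (toW k u)) (λ k v → 𝟙 (fromW k v))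
                           (charMat R λ' (A R D₂)) N inv
      using (block; blockMatrix; blockMatrix-join; schurComplement; det-blockMatrix)

    private
      b = m ℕ.* n₂
      corona = coronaArc m D₁ D₂ toW fromW

    coronaBlock : Fin n₁ ⊎ Fin b → Fin n₁ ⊎ Fin b → Bool
    coronaBlock (inj₁ u) (inj₁ v) = arc D₁ u v
    coronaBlock (inj₁ u) (inj₂ q) = toW (quotient {m} n₂ q) u
    coronaBlock (inj₂ p) (inj₁ v) = fromW (quotient {m} n₂ p) v
    coronaBlock (inj₂ p) (inj₂ q) = (quotient {m} n₂ p == quotient {m} n₂ q) ∧ arc D₂ (remainder {m} n₂ p) (remainder {m} n₂ q)

    coronaArc-split : ∀ i j → corona i j ≡ coronaBlock (splitAt n₁ i) (splitAt n₁ j)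
    coronaArc-split i j with splitAt n₁ i | splitAt n₁ j
    ... | inj₁ u | inj₁ v = ≡.refl
    ... | inj₁ u | inj₂ q = ≡.refl
    ... | inj₂ p | inj₁ v = ≡.refl
    ... | inj₂ p | inj₂ q = ≡.refl

    charMat-diagonal-block : ∀ p q →
      (if p == q then λ' else 0#) - 𝟙 (coronaBlock (inj₂ p) (inj₂ q)) ≈ blockDiagonal m (charMat R λ' (A R D₂)) p q
    charMat-diagonal-block p q = by-block (quotient {m} n₂ p Fin.≟ quotient {m} n₂ q)
      where
      rp = remainder {m} n₂ p
      rq = remainder {m} n₂ q
      by-block : Dec (quotient {m} n₂ p ≡ quotient {m} n₂ q) →
        (if p == q then λ' else 0#) - 𝟙 (coronaBlock (inj₂ p) (inj₂ q)) ≈ blockDiagonal m (charMat R λ' (A R D₂)) p q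
      by-block (yes same) = begin
        (if p == q then λ' else 0#) - 𝟙 ((quotient {m} n₂ p == quotient {m} n₂ q) ∧ arc D₂ rp rq)
          ≡⟨ ≡.cong₂ (λ d e → (if d then λ' else 0#) - 𝟙 (e ∧ arc D₂ rp rq))
                     (==-iff (≡.cong (remainder {m} n₂)) (quotient-remainder-injective same)) (==-true same) ⟩
        charMat R λ' (A R D₂) rp rq
          ≈⟨ sym (*-identityˡ _) ⟩
        1# * charMat R λ' (A R D₂) rp rq
          ≈⟨ *-congʳ (sym (≡.subst (λ k → idMat R (quotient {m} n₂ p) k ≈ 1#) same (idMat-diag (quotient {m} n₂ p)))) ⟩
        blockDiagonal m (charMat R λ' (A R D₂)) p q ∎
      by-block (no different) = begin
        (if p == q then λ' else 0#) - 𝟙 ((quotient {m} n₂ p == quotient {m} n₂ q) ∧ arc D₂ rp rq)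
          ≡⟨ ≡.cong₂ (λ d e → (if d then λ' else 0#) - 𝟙 (e ∧ arc D₂ rp rq))
                     (==-false (different ∘ ≡.cong (quotient {m} n₂))) (==-false different) ⟩
        0# - 0#                                      ≈⟨ -‿inverseʳ 0# ⟩
        0#                                           ≈⟨ sym (zeroˡ _) ⟩
        0# * charMat R λ' (A R D₂) rp rq             ≈⟨ *-congʳ (sym (idMat-off different)) ⟩
        blockDiagonal m (charMat R λ' (A R D₂)) p q ∎

    charMat-corona-join : ∀ x y →
      charMat R λ' (relMat R corona) (Fin.join n₁ b x) (Fin.join n₁ b y) ≈ block x y
    charMat-corona-join x y = begin
      (if join x == join y then λ' else 0#) - 𝟙 (corona (join x) (join y))
        ≡⟨ ≡.cong (λ e → (if join x == join y then λ' else 0#) - 𝟙 e)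
             (≡.trans (coronaArc-split (join x) (join y)) (≡.cong₂ coronaBlock (Fin.splitAt-join n₁ b x) (Fin.splitAt-join n₁ b y))) ⟩
      (if join x == join y then λ' else 0#) - 𝟙 (coronaBlock x y)
        ≈⟨ by-blocks x y ⟩
      block x y ∎
      where
      join = Fin.join n₁ b
      diagonal-as : ∀ {x y d} → (join x == join y) ≡ d →
        (if join x == join y then λ' else 0#) - 𝟙 (coronaBlock x y) ≡ (if d then λ' else 0#) - 𝟙 (coronaBlock x y)
      diagonal-as {x} {y} eq = ≡.cong (λ d → (if d then λ' else 0#) - 𝟙 (coronaBlock x y)) eq
      by-blocks : ∀ x y → (if join x == join y then λ' else 0#) - 𝟙 (coronaBlock x y) ≈ block x y
      by-blocks (inj₁ s) (inj₁ u) = reflexive (diagonal-as {inj₁ s} {inj₁ u} (==-iff (Fin.↑ˡ-injective b s u) (≡.cong (_↑ˡ b))))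
      by-blocks (inj₁ s) (inj₂ q) = reflexive (diagonal-as {inj₁ s} {inj₂ q} (==-false (↑ʳ≢↑ˡ n₁ q s ∘ ≡.sym)))
      by-blocks (inj₂ p) (inj₁ u) = reflexive (diagonal-as {inj₂ p} {inj₁ u} (==-false (↑ʳ≢↑ˡ n₁ p u)))
      by-blocks (inj₂ p) (inj₂ q) = trans (reflexive (diagonal-as {inj₂ p} {inj₂ q} (==-iff (Fin.↑ʳ-injective n₁ p q) (≡.cong (n₁ ↑ʳ_)))))
                                          (charMat-diagonal-block p q)

    charPoly-coronaArc : charPoly R (relMat R corona) λ' ≈ pow R (charPoly R (A R D₂) λ') m * det R schurComplement
    charPoly-coronaArc = trans (det-cong charMat≋blockMatrix) det-blockMatrix
      where
      charMat≋blockMatrix : charMat R λ' (relMat R corona) ≋ blockMatrix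
      charMat≋blockMatrix i j = ≡.subst₂ (λ i′ j′ → charMat R λ' (relMat R corona) i′ j′ ≈ blockMatrix i′ j′)
        (Fin.join-splitAt n₁ b i) (Fin.join-splitAt n₁ b j)
        (trans (charMat-corona-join (splitAt n₁ i) (splitAt n₁ j)) (reflexive (≡.sym (blockMatrix-join (splitAt n₁ i) (splitAt n₁ j)))))

  module _ {n₁ n₂ : ℕ} (D₁ : Digraph n₁) (D₂ : Digraph n₂) (λ' : Carrier) (N : Mat R n₂ n₂)
           (inv : IsInverse R (charMat R λ' (A R D₂)) N) where
    private
      χ = coronalOf R N
      f₂ = charPoly R (A R D₂) λ'

    charPoly-forwardArcCorona : charPoly R (relMat R (fwdArc D₁ D₂)) λ'
      ≈ pow R f₂ (numArcs D₁) * det R (λ s u → charMat R λ' (A R D₁) s u - χ * A R D₁ s u)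
    charPoly-forwardArcCorona = trans (charPoly-coronaArc D₁ D₂ _ _ λ' N inv)
      (*-congˡ (det-cong (λ s u → +-congˡ (-‿cong (*-congˡ (sum-arcs-forward D₁ s u))))))

    charPoly-backwardArcCorona : charPoly R (relMat R (bwdArc D₁ D₂)) λ' ≈ pow R f₂ (numArcs D₁) * det R (bwdMat R λ' χ D₁)
    charPoly-backwardArcCorona = trans (charPoly-coronaArc D₁ D₂ _ _ λ' N inv)
      (*-congˡ (det-cong (λ s u → +-congˡ (-‿cong (*-congˡ (sum-arcs-backward D₁ s u))))))

    charPoly-symmetricArcCorona : charPoly R (relMat R (symArc D₁ D₂)) λ' ≈ pow R f₂ (numEdges D₁) * det R (symMat R λ' χ D₁)
    charPoly-symmetricArcCorona = trans (charPoly-coronaArc D₁ D₂ _ _ λ' N inv)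
      (*-congˡ (det-cong (λ s u → +-congˡ (-‿cong (*-congˡ (sum-edges D₁ s u))))))

  -- λI − (1 + t)M = (1 + t)(λeI − M) when e is an inverse of 1 + t.
  det-λI-[1+t]M : ∀ {n} (M : Mat R n n) λ' t e → (1# + t) * e ≈ 1# →
    det R (λ s u → charMat R λ' M s u - t * M s u) ≈ pow R (1# + t) n * charPoly R M (λ' * e)
  det-λI-[1+t]M M λ' t e inverse = trans (det-cong entry) (det-scale (1# + t) (charMat R (λ' * e) M))
    where
    diagonal : ∀ d → (if d then λ' else 0#) ≈ (1# + t) * (if d then λ' * e else 0#)
    diagonal true  = sym (trans (*-congˡ (*-comm λ' e)) (trans (sym (*-assoc _ _ _)) (trans (*-congʳ inverse) (*-identityˡ λ'))))
    diagonal false = sym (zeroʳ _)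
    entry : ∀ s u → charMat R λ' M s u - t * M s u ≈ (1# + t) * charMat R (λ' * e) M s u
    entry s u = begin
      (δλ - M s u) - t * M s u                ≈⟨ +-assoc _ _ _ ⟩
      δλ + (- M s u + - (t * M s u))          ≈⟨ +-congˡ (-‿+-comm _ _) ⟩
      δλ - (M s u + t * M s u)                ≈⟨ +-cong (diagonal (s == u)) (-‿cong (trans (+-congʳ (sym (*-identityˡ _))) (sym (distribʳ _ _ _)))) ⟩
      (1# + t) * δλe - (1# + t) * M s u       ≈⟨ sym (x[y-z]≈xy-xz _ _ _) ⟩
      (1# + t) * (δλe - M s u)                ∎
      where
      δλ = if s == u then λ' else 0#
      δλe = if s == u then λ' * e else 0#

theorem4p3 : ∀ {c ℓ : Level} (R : CommutativeRing c ℓ) →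
    let open CommutativeRing R in
    ∀ {n₁ n₂ : ℕ} (D₁ : Digraph n₁) (D₂ : Digraph n₂) (λ' : Carrier)
      (N : Mat R n₂ n₂) → IsInverse R (charMat R λ' (A R D₂)) N →
    let χ = coronalOf R N
        f₂ = charPoly R (A R D₂) λ'
    in (∀ (e : Carrier) → (1# + χ) * e ≈ 1# →
          charPoly R (relMat R (fwdArc D₁ D₂)) λ'
            ≈ pow R f₂ (numArcs D₁) * (pow R (1# + χ) n₁ * charPoly R (A R D₁) (λ' * e)))
     × (charPoly R (relMat R (bwdArc D₁ D₂)) λ'
            ≈ pow R f₂ (numArcs D₁) * det R (bwdMat R λ' χ D₁))
     × (charPoly R (relMat R (symArc D₁ D₂)) λ'
            ≈ pow R f₂ (numEdges D₁) * det R (symMat R λ' χ D₁))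
theorem4p3 R D₁ D₂ λ' N inv =
    (λ e inverse → trans (charPoly-forwardArcCorona D₁ D₂ λ' N inv)
                         (*-congˡ (det-λI-[1+t]M (A R D₁) λ' (coronalOf R N) e inverse)))
  , charPoly-backwardArcCorona D₁ D₂ λ' N inv
  , charPoly-symmetricArcCorona D₁ D₂ λ' N inv
  where
  open CommutativeRing R using (trans; *-congˡ)
  open ArcCorona R
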